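{- Let $1\le l\le m$ be an integer. Then $\mathcal{C}_{X_m,l,1}$ equals the submonoid of $\mathcal{B}_m$ generated by $\mathcal{A}_{0,l}\cup\mathcal{A}_{1,m}$. Moreover, $(n;H_1,\dots,H_m)\in\mathcal{B}_m$ lies in $\mathcal{C}_{X_m,l,1}$ if and only if there is a non-negative integer $\alpha_0\ge\max_{1\le i\le m}d_{0,i}$ with $\sum_{i=1}^md_{0,i}-(m-l)\alpha_0\ge0$.
   Context: Fix a prime $p$; $\mathbb{Z}_p$ is the $p$-adic integers; $\overline{\mathbb{Z}}_{\ge c}=\{x\in\mathbb{Z}:x\ge c\}\cup\{\infty\}$, $p^\infty=0$ (so $\mathbb{Z}_p/p^0\mathbb{Z}_p=0$, $\mathbb{Z}_p/p^\infty\mathbb{Z}_p=\mathbb{Z}_p$). $X_m=\{x_1,\dots,x_m\}$ is an ordered subset of $\mathbb{Z}_p$ of size $m$ with pairwise distinct reductions mod $p$. $\mathcal{M}_{\mathbb{Z}_p}$: isomorphism classes of finitely generated $\mathbb{Z}_p$-modules; $s(H)=\dim_{\mathbb{F}_p}(H/pH)$. $\mathcal{B}_m:=\{(n;H_1,\dots,H_m)\in\mathbb{Z}_{\ge0}\times\mathcal{M}_{\mathbb{Z}_p}^m: n\ge s(H_i)\ \forall i\}$, with $H_i\cong\prod_{r\in\overline{\mathbb{Z}}_{\ge1}}(\mathbb{Z}_p/p^r\mathbb{Z}_p)^{d_{r,i}}$, $d_{0,i}:=n-\sum_{r\ge1}d_{r,i}$, and monoid operation $(n;H_1,\dots,H_m)+(n';H'_1,\dots,H'_m)=(n+n';H_1\times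 H_1',\dots,H_m\times H_m')$ with identity $(0;0,\dots,0)$. The symmetric group $S_m$ acts on $\mathcal{B}_m$ by $\sigma\cdot(n;H_1,\dots,H_m)=(n;H_{\sigma(1)},\dots,H_{\sigma(m)})$. For $r\in\overline{\mathbb{Z}}_{\ge0}$ and $0\le d\le m$, $\mathcal{A}_{r,d}$ is the set of all $\sigma\cdot(1;\mathbb{Z}_p/p^{r_1}\mathbb{Z}_p,\dots,\mathbb{Z}_p/p^{r_d}\mathbb{Z}_p,\mathbb{Z}_p/p^r\mathbb{Z}_p,\dots,\mathbb{Z}_p/p^r\mathbb{Z}_p)$ with $\sigma\in S_m$ and $r_1,\dots,r_d\in\overline{\mathbb{Z}}_{\ge r}$. An $l$-th integral is a polynomial in $\operatorname{M}_n(\mathbb{Z}_p)[t]$ of the form $A_0+tA_1+\dots+t^lA_l+pt^{l+1}A_{l+1}+\dots+p^rt^{l+r}A_{l+r}$. $\mathcal{C}_{X_m,l,1}$ is the set of $(n;H_1,\dots,H_m)\in\mathcal{B}_m$ such that some $l$-th integral $P(t)\in\operatorname{M}_n(\mathbb{Z}_p)[t]$ satisfies $\operatorname{cok}_{\mathbb{F}_p}(\overline{P(x_i)})\cong H_i/pH_i$ for all $i$ ($\overline{\,\cdot\,}$ = reduction mod $p$). -}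

module Defs where

open import Data.Nat as ℕ using (ℕ; zero; suc; _∸_; _≤_; _<_)
open import Data.Integer as ℤ using (ℤ; +_; _+_; _*_; _-_)
open import Data.Integer.Divisibility using (_∣_)
open import Data.Fin using (Fin; toℕ)
open import Data.Fin.Permutation using (Permutation′; _⟨$⟩ʳ_)
open import Data.List using (List; []; _∷_; length; _++_)
open import Data.List.Relation.Binary.Permutation.Propositional using (_↭_)
open import Data.Product using (Σ; ∃; _×_; _,_)
open import Relation.Binary.PropositionalEquality using (_≡_)

infix 4 _≡[mod_]_
_≡[mod_]_ : ℤ → ℕ → ℤ → Set
a ≡[mod p ] b = (+ p) ∣ (a - b)

-- p-adic integers: ℤ_p = lim ℤ/p^k, represented by coherent sequences
-- (x_k)_k of integers with x_{k+1} ≡ x_k (mod p^k).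

record Zp (p : ℕ) : Set where
  field
    seq : ℕ → ℤ
    coh : ∀ k → (seq (suc k)) ≡[mod (p ℕ.^ k) ] (seq k)
open Zp public

-- reduction mod p : ℤ_p → F_p  (component at level 1, read mod p)
red : ∀ {p} → Zp p → ℤ
red x = seq x 1

sumℤ : ℕ → (ℕ → ℤ) → ℤ
sumℤ zero    f = + 0
sumℤ (suc n) f = sumℤ n f + f n

sumFin : (n : ℕ) → (Fin n → ℤ) → ℤ
sumFin zero    f = + 0
sumFin (suc n) f = f Fin.zero + sumFin n (λ j → f (Fin.suc j))
  where import Data.Fin as Fin

sumFinℕ : (n : ℕ) → (Fin n → ℕ) → ℕ
sumFinℕ zero    f = 0
sumFinℕ (suc n) f = f Fin.zero ℕ.+ sumFinℕ n (λ j → f (Fin.suc j))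
  where import Data.Fin as Fin

-- An l-th integral P(t) ∈ M_n(ℤ_p)[t] is given by r : ℕ and matrices
-- A j ∈ M_n(ℤ_p) (j = 0 .. l+r; other A j unused):
--   P(t) = Σ_{j ≤ l+r} p^(j ∸ l) t^j A_j
-- The evaluation P(x) ∈ M_n(ℤ_p), entry (a,b), at level k of the
-- inverse limit (ring operations of ℤ_p are componentwise):

MatZp : ℕ → ℕ → Set
MatZp p n = Fin n → Fin n → Zp p

evalIntegralSeq : (p l r n : ℕ) → (ℕ → MatZp p n) → Zp p →
                  Fin n → Fin n → ℕ → ℤ
evalIntegralSeq p l r n A x a b k =
  sumℤ (suc (l ℕ.+ r))
       (λ j → ((+ p) ℤ.^ (j ∸ l)) * seq (A j a b) k * (seq x k ℤ.^ j))

redEvalIntegral : (p l r n : ℕ) → (ℕ → MatZp p n) → Zp p → Fin n → Fin n → ℤ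
redEvalIntegral p l r n A x a b = evalIntegralSeq p l r n A x a b 1

mulMV : ∀ {s n} → (Fin s → Fin n → ℤ) → (Fin n → ℤ) → Fin s → ℤ
mulMV {n = n} M v k = sumFin n (λ j → M k j * v j)

-- cok_{F_p}(M) ≅ F_p^s  for an n×n matrix M over F_p :
-- there is an F_p-linear map φ : F_p^n → F_p^s which is surjective and
-- whose kernel is exactly the image of M.
CokIso : (p n : ℕ) → (Fin n → Fin n → ℤ) → (s : ℕ) → Set
CokIso p n M s =
  Σ (Fin s → Fin n → ℤ) λ φ →
    (∀ (y : Fin s → ℤ) → Σ (Fin n → ℤ) λ v → ∀ k → mulMV φ v k ≡[mod p ] y k)
  × (∀ (v : Fin n → ℤ) →
       ((∀ k → mulMV φ v k ≡[mod p ] + 0) → Σ (Fin n → ℤ) λ w → ∀ k → mulMV M w k ≡[mod p ] v k)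
     × ((Σ (Fin n → ℤ) λ w → ∀ k → mulMV M w k ≡[mod p ] v k) → ∀ k → mulMV φ v k ≡[mod p ] + 0))

data ℕ∞ : Set where
  fin : ℕ → ℕ∞
  ∞   : ℕ∞

data _≤∞_ : ℕ∞ → ℕ∞ → Set where
  fin≤fin : ∀ {a b} → a ≤ b → fin a ≤∞ fin b
  _≤∞∞    : ∀ x → x ≤∞ ∞

-- positive exponents r ∈ ℕ̄_{≥1}: pfin k stands for r = k+1, pinf for r = ∞
data PExp : Set where
  pfin : ℕ → PExp
  pinf : PExp

-- H ≅ ∏_j ℤ_p / p^{r_j} ℤ_p  (r_j ≥ 1), an isomorphism class is the
-- multiset of the r_j: a list taken up to permutation (_↭_).
FGMod : Set
FGMod = List PExp

_≅M_ : FGMod → FGMod → Set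
H ≅M H' = H ↭ H'

-- s(H) = dim_{F_p} H/pH
s : FGMod → ℕ
s = length

-- the cyclic module ℤ_p / p^r ℤ_p, r ∈ ℕ̄_{≥0}  (p^∞ = 0)
cyc : ℕ∞ → FGMod
cyc (fin zero)    = []
cyc (fin (suc k)) = pfin k ∷ []
cyc ∞             = pinf ∷ []

record Bm (m : ℕ) : Set where
  constructor ⟨_⨾_⟩
  field
    n : ℕ
    H : Fin m → FGMod
open Bm public

InB : ∀ {m} → Bm m → Set
InB b = ∀ i → s (H b i) ≤ n b

_≈B_ : ∀ {m} → Bm m → Bm m → Set
b ≈B c = (n b ≡ n c) × (∀ i → H b i ≅M H c i)

0B : ∀ {m} → Bm m
0B = ⟨ 0 ⨾ (λ _ → []) ⟩

_+B_ : ∀ {m} → Bm m → Bm m → Bm m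
b +B c = ⟨ n b ℕ.+ n c ⨾ (λ i → H b i ++ H c i) ⟩

act : ∀ {m} → Permutation′ m → Bm m → Bm m
act σ b = ⟨ n b ⨾ (λ i → H b (σ ⟨$⟩ʳ i)) ⟩

data Gen {m} (S : Bm m → Set) : Bm m → Set where
  gen-zero : Gen S 0B
  gen-el   : ∀ {b} → S b → Gen S b
  gen-add  : ∀ {b c} → Gen S b → Gen S c → Gen S (b +B c)
  gen-iso  : ∀ {b c} → b ≈B c → Gen S b → Gen S c

-- 𝓐_{r,d} : all σ·(1; ℤ_p/p^{r_1},…,ℤ_p/p^{r_d}, ℤ_p/p^r,…,ℤ_p/p^r)
-- with σ ∈ S_m and r_1..r_d ∈ ℕ̄_{≥ r}
Acal : ∀ {m} → ℕ∞ → ℕ → Bm m → Set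
Acal {m} r d b =
  Σ (Permutation′ m) λ σ → Σ (Fin m → ℕ∞) λ e →
    (∀ j → r ≤∞ e j) × (∀ j → d ≤ toℕ j → e j ≡ r)
    × (b ≈B act σ ⟨ 1 ⨾ (λ j → cyc (e j)) ⟩)

Ccal : ∀ {m} (p : ℕ) → (Fin m → Zp p) → ℕ → Bm m → Set
Ccal p x l b =
  Σ ℕ λ r → Σ (ℕ → MatZp p (n b)) λ A →
    ∀ i → CokIso p (n b) (redEvalIntegral p l r (n b) A (x i)) (s (H b i))

-- d_{0,i} = n − Σ_{r ≥ 1} d_{r,i} = n − s(H_i)
d0 : ∀ {m} → Bm m → Fin m → ℕ
d0 b i = n b ∸ s (H b i)

-- Reduced mod p, an l-th integral is a matrix polynomial Q of degree ≤ l over F_p, and d₀,ᵢ is the rank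
-- of Q(xᵢ). Necessity: let x_{i₀} have maximal rank r₀ and pick r₀ columns Q(x_{i₀}) e_j independent there.
-- The (m - l) r₀ vectors i ↦ (xᵢ - x_{i₀})^h Q(xᵢ) e_j (h < m - l) of ⊕ᵢ F_p^n lie in ⊕ᵢ im Q(xᵢ), and they
-- are independent because a polynomial of degree < m vanishing at the m distinct points xᵢ is zero; hence
-- (m - l) r₀ ≤ Σᵢ d₀,ᵢ. Sufficiency: block sums realize sums in ℬ_m, the zero 1×1 polynomial realizes 𝒜_{1,m},
-- the product of t - x_{σ⁻¹ j} over the positions j < l of positive exponent realizes 𝒜_{0,l}, and a greedy
-- peeling of one row at a time writes every element satisfying the α₀-condition as a sum of such generators.

module Submission where

open import Defs
open import Data.Nat as ℕ using (ℕ; zero; suc; _∸_; _≤_; _<_; z≤n; s≤s)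
import Data.Nat.Properties as ℕₚ
open import Data.Nat.Primality using (Prime)
open import Data.Integer as Int using (ℤ; +_; -[1+_])
import Data.Integer.Properties as ℤₚ
open import Data.Integer.Tactic.RingSolver using (solve-∀)
open import Data.Fin as Fin using (Fin; toℕ; _↑ˡ_; _↑ʳ_; splitAt; punchIn; punchOut)
import Data.Fin.Properties as Finₚ
open import Data.Product using (Σ; ∃; _×_; _,_; proj₁; proj₂)
open import Data.Sum using (_⊎_; inj₁; inj₂)
open import Data.Empty using (⊥-elim)
open import Function.Base using (_∘_)
open import Function.Bundles using (_⇔_; mk⇔)
open import Relation.Nullary using (¬_; Dec; yes; no)
open import Relation.Binary.PropositionalEquality
import Algebra.Properties.CommutativeSemigroup as CommSemigroupₚ

Generator : ∀ m → ℕ → Bm m → Set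
Generator m l c = Acal (fin 0) l c ⊎ Acal (fin 1) m c

Balanced : ∀ {m} → ℕ → Bm m → Set
Balanced {m} l b = ∃ λ α₀ → (∀ i → d0 b i ≤ α₀) × ((m ∸ l) ℕ.* α₀ ≤ sumFinℕ m (d0 b))

module FiniteSums where

  open Int using (_+_; _*_; -_)
  open CommSemigroupₚ ℤₚ.+-commutativeSemigroup using (interchange)
  open CommSemigroupₚ ℕₚ.+-commutativeSemigroup using () renaming (interchange to ℕ-interchange)

  sumFin-cong : ∀ n {f g : Fin n → ℤ} → (∀ j → f j ≡ g j) → sumFin n f ≡ sumFin n g
  sumFin-cong zero    f≗g = refl
  sumFin-cong (suc n) f≗g = cong₂ _+_ (f≗g Fin.zero) (sumFin-cong n (λ j → f≗g (Fin.suc j)))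

  sumFin-zero : ∀ n → sumFin n (λ _ → + 0) ≡ + 0
  sumFin-zero zero    = refl
  sumFin-zero (suc n) = trans (ℤₚ.+-identityˡ _) (sumFin-zero n)

  sumFin-distrib-+ : ∀ n (f g : Fin n → ℤ) → sumFin n (λ j → f j + g j) ≡ sumFin n f + sumFin n g
  sumFin-distrib-+ zero    f g = refl
  sumFin-distrib-+ (suc n) f g =
    trans (cong (_+_ (f Fin.zero + g Fin.zero)) (sumFin-distrib-+ n (λ j → f (Fin.suc j)) (λ j → g (Fin.suc j))))
          (interchange (f Fin.zero) (g Fin.zero) _ _)

  sumFin-*ˡ : ∀ n c (f : Fin n → ℤ) → sumFin n (λ j → c * f j) ≡ c * sumFin n f
  sumFin-*ˡ zero    c f = sym (ℤₚ.*-zeroʳ c)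
  sumFin-*ˡ (suc n) c f =
    trans (cong (_+_ (c * f Fin.zero)) (sumFin-*ˡ n c _)) (sym (ℤₚ.*-distribˡ-+ c _ _))

  sumFin-*ʳ : ∀ n c (f : Fin n → ℤ) → sumFin n (λ j → f j * c) ≡ sumFin n f * c
  sumFin-*ʳ n c f =
    trans (sumFin-cong n (λ j → ℤₚ.*-comm (f j) c)) (trans (sumFin-*ˡ n c f) (ℤₚ.*-comm c _))

  sumFin-neg : ∀ n (f : Fin n → ℤ) → sumFin n (λ j → - f j) ≡ - sumFin n f
  sumFin-neg zero    f = refl
  sumFin-neg (suc n) f =
    trans (cong (_+_ (- f Fin.zero)) (sumFin-neg n _)) (sym (ℤₚ.neg-distrib-+ (f Fin.zero) _))

  sumFin-comm : ∀ a b (f : Fin a → Fin b → ℤ) →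
    sumFin a (λ j → sumFin b (f j)) ≡ sumFin b (λ k → sumFin a (λ j → f j k))
  sumFin-comm zero    b f = sym (sumFin-zero b)
  sumFin-comm (suc a) b f =
    trans (cong (_+_ (sumFin b (f Fin.zero))) (sumFin-comm a b (λ j → f (Fin.suc j))))
          (sym (sumFin-distrib-+ b _ _))

  sumFin-++ : ∀ a b (f : Fin (a ℕ.+ b) → ℤ) →
    sumFin (a ℕ.+ b) f ≡ sumFin a (λ j → f (j ↑ˡ b)) + sumFin b (λ k → f (a ↑ʳ k))
  sumFin-++ zero    b f = sym (ℤₚ.+-identityˡ _)
  sumFin-++ (suc a) b f =
    trans (cong (_+_ (f Fin.zero)) (sumFin-++ a b (λ j → f (Fin.suc j)))) (sym (ℤₚ.+-assoc (f Fin.zero) _ _))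

  sumℤ-cong : ∀ n {f g : ℕ → ℤ} → (∀ j → j < n → f j ≡ g j) → sumℤ n f ≡ sumℤ n g
  sumℤ-cong zero    f≗g = refl
  sumℤ-cong (suc n) f≗g = cong₂ _+_ (sumℤ-cong n (λ j j<n → f≗g j (ℕₚ.m<n⇒m<1+n j<n))) (f≗g n ℕₚ.≤-refl)

  sumℤ-zero : ∀ n → sumℤ n (λ _ → + 0) ≡ + 0
  sumℤ-zero zero    = refl
  sumℤ-zero (suc n) = trans (ℤₚ.+-identityʳ _) (sumℤ-zero n)

  sumℤ-distrib-+ : ∀ n (f g : ℕ → ℤ) → sumℤ n (λ j → f j + g j) ≡ sumℤ n f + sumℤ n g
  sumℤ-distrib-+ zero    f g = refl
  sumℤ-distrib-+ (suc n) f g =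
    trans (cong (_+ (f n + g n)) (sumℤ-distrib-+ n f g)) (interchange (sumℤ n f) (sumℤ n g) (f n) (g n))

  sumℤ-*ˡ : ∀ n c (f : ℕ → ℤ) → sumℤ n (λ j → c * f j) ≡ c * sumℤ n f
  sumℤ-*ˡ zero    c f = sym (ℤₚ.*-zeroʳ c)
  sumℤ-*ˡ (suc n) c f = trans (cong (_+ c * f n) (sumℤ-*ˡ n c f)) (sym (ℤₚ.*-distribˡ-+ c (sumℤ n f) (f n)))

  sumℤ-++ : ∀ a b (f : ℕ → ℤ) → sumℤ (a ℕ.+ b) f ≡ sumℤ a f + sumℤ b (λ j → f (a ℕ.+ j))
  sumℤ-++ a zero    f = trans (cong (λ k → sumℤ k f) (ℕₚ.+-identityʳ a)) (sym (ℤₚ.+-identityʳ _))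
  sumℤ-++ a (suc b) f = trans (cong (λ k → sumℤ k f) (ℕₚ.+-suc a b))
    (trans (cong (_+ f (a ℕ.+ b)) (sumℤ-++ a b f)) (ℤₚ.+-assoc (sumℤ a f) _ _))

  sumℤ-head : ∀ n (f : ℕ → ℤ) → sumℤ (suc n) f ≡ f 0 + sumℤ n (λ j → f (suc j))
  sumℤ-head zero    f = trans (ℤₚ.+-identityˡ (f 0)) (sym (ℤₚ.+-identityʳ (f 0)))
  sumℤ-head (suc n) f =
    trans (cong (_+ f (suc n)) (sumℤ-head n f)) (ℤₚ.+-assoc (f 0) _ (f (suc n)))

  δ : ∀ {n} → Fin n → Fin n → ℤ
  δ i j with i Finₚ.≟ j
  ... | yes _ = + 1
  ... | no  _ = + 0

  δ-diag : ∀ {n} (i : Fin n) → δ i i ≡ + 1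
  δ-diag i with i Finₚ.≟ i
  ... | yes _  = refl
  ... | no i≢i = ⊥-elim (i≢i refl)

  δ-off : ∀ {n} {i j : Fin n} → i ≢ j → δ i j ≡ + 0
  δ-off {i = i} {j} i≢j with i Finₚ.≟ j
  ... | yes i≡j = ⊥-elim (i≢j i≡j)
  ... | no  _   = refl

  sumFin-δ : ∀ n (f : Fin n → ℤ) (i : Fin n) → sumFin n (λ k → f k * δ k i) ≡ f i
  sumFin-δ n f i = begin
    sumFin n (λ k → f k * δ k i) ≡⟨ sumFin-single n _ i (λ k k≢i → trans (cong (f k *_) (δ-off k≢i)) (ℤₚ.*-zeroʳ (f k))) ⟩
    f i * δ i i                  ≡⟨ cong (f i *_) (δ-diag i) ⟩
    f i * + 1                    ≡⟨ ℤₚ.*-identityʳ (f i) ⟩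
    f i                          ∎
    where
    open ≡-Reasoning
    sumFin-single : ∀ n (g : Fin n → ℤ) i → (∀ k → k ≢ i → g k ≡ + 0) → sumFin n g ≡ g i
    sumFin-single (suc n) g Fin.zero g≡0 =
      trans (cong (_+_ (g Fin.zero)) (trans (sumFin-cong n (λ k → g≡0 (Fin.suc k) λ ())) (sumFin-zero n)))
            (ℤₚ.+-identityʳ _)
    sumFin-single (suc n) g (Fin.suc i) g≡0 =
      trans (cong₂ _+_ (g≡0 Fin.zero λ ()) (sumFin-single n (λ k → g (Fin.suc k)) i
                                              (λ k k≢i → g≡0 (Fin.suc k) (λ eq → k≢i (Finₚ.suc-injective eq)))))
            (ℤₚ.+-identityˡ _)

  sumFinℕ-cong : ∀ n {f g : Fin n → ℕ} → (∀ j → f j ≡ g j) → sumFinℕ n f ≡ sumFinℕ n g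
  sumFinℕ-cong zero    f≗g = refl
  sumFinℕ-cong (suc n) f≗g = cong₂ ℕ._+_ (f≗g Fin.zero) (sumFinℕ-cong n (λ j → f≗g (Fin.suc j)))

  sumFinℕ-mono-≤ : ∀ n {f g : Fin n → ℕ} → (∀ j → f j ≤ g j) → sumFinℕ n f ≤ sumFinℕ n g
  sumFinℕ-mono-≤ zero    f≤g = z≤n
  sumFinℕ-mono-≤ (suc n) f≤g = ℕₚ.+-mono-≤ (f≤g Fin.zero) (sumFinℕ-mono-≤ n (λ j → f≤g (Fin.suc j)))

  sumFinℕ-const : ∀ n c → sumFinℕ n (λ _ → c) ≡ n ℕ.* c
  sumFinℕ-const zero    c = refl
  sumFinℕ-const (suc n) c = cong (c ℕ.+_) (sumFinℕ-const n c)

  sumFinℕ-distrib-+ : ∀ n (f g : Fin n → ℕ) → sumFinℕ n (λ j → f j ℕ.+ g j) ≡ sumFinℕ n f ℕ.+ sumFinℕ n g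
  sumFinℕ-distrib-+ zero    f g = refl
  sumFinℕ-distrib-+ (suc n) f g =
    trans (cong ((f Fin.zero ℕ.+ g Fin.zero) ℕ.+_) (sumFinℕ-distrib-+ n (λ j → f (Fin.suc j)) (λ j → g (Fin.suc j))))
          (ℕ-interchange (f Fin.zero) (g Fin.zero) _ _)

  sumFinℕ-*ʳ : ∀ n c (f : Fin n → ℕ) → sumFinℕ n (λ i → f i ℕ.* c) ≡ sumFinℕ n f ℕ.* c
  sumFinℕ-*ʳ zero    c f = refl
  sumFinℕ-*ʳ (suc n) c f =
    trans (cong ((f Fin.zero ℕ.* c) ℕ.+_) (sumFinℕ-*ʳ n c (λ i → f (Fin.suc i))))
          (sym (ℕₚ.*-distribʳ-+ c (f Fin.zero) _))

  argmax : ∀ m (f : Fin (suc m) → ℕ) → ∃ λ i₀ → ∀ i → f i ≤ f i₀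
  argmax zero    f = Fin.zero , λ { Fin.zero → ℕₚ.≤-refl }
  argmax (suc m) f with argmax m (λ i → f (Fin.suc i))
  ... | i₁ , max₁ with f Fin.zero ℕ.≤? f (Fin.suc i₁)
  ...   | yes f₀≤ = Fin.suc i₁ , λ { Fin.zero → f₀≤ ; (Fin.suc i) → max₁ i }
  ...   | no  f₀≰ = Fin.zero , λ { Fin.zero → ℕₚ.≤-refl ; (Fin.suc i) → ℕₚ.≤-trans (max₁ i) (ℕₚ.<⇒≤ (ℕₚ.≰⇒> f₀≰)) }

  unflatten : ∀ m (r : Fin m → ℕ) → Fin (sumFinℕ m r) → Σ (Fin m) (λ i → Fin (r i))
  unflatten-⊎ : ∀ m (r : Fin (suc m) → ℕ) → Fin (r Fin.zero) ⊎ Fin (sumFinℕ m (λ i → r (Fin.suc i))) →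
                Σ (Fin (suc m)) (λ i → Fin (r i))
  unflatten (suc m) r k = unflatten-⊎ m r (splitAt (r Fin.zero) k)
  unflatten-⊎ m r (inj₁ t)  = Fin.zero , t
  unflatten-⊎ m r (inj₂ k′) = let (i , t) = unflatten m (λ i → r (Fin.suc i)) k′ in Fin.suc i , t

  flatten : ∀ m (r : Fin m → ℕ) → Σ (Fin m) (λ i → Fin (r i)) → Fin (sumFinℕ m r)
  flatten (suc m) r (Fin.zero  , t) = t ↑ˡ _
  flatten (suc m) r (Fin.suc i , t) = r Fin.zero ↑ʳ flatten m (λ i → r (Fin.suc i)) (i , t)

  flatten-unflatten : ∀ m (r : Fin m → ℕ) k → flatten m r (unflatten m r k) ≡ k
  flatten-unflatten (suc m) r k with splitAt (r Fin.zero) k in eq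
  ... | inj₁ t  = trans (cong (Fin.join _ _) (sym eq)) (Finₚ.join-splitAt (r Fin.zero) _ k)
  ... | inj₂ k′ = trans (cong (r Fin.zero ↑ʳ_) (flatten-unflatten m (λ i → r (Fin.suc i)) k′))
                        (trans (cong (Fin.join _ _) (sym eq)) (Finₚ.join-splitAt (r Fin.zero) _ k))

  sumFin-unflatten : ∀ m (r : Fin m → ℕ) (f : Σ (Fin m) (λ i → Fin (r i)) → ℤ) →
    sumFin (sumFinℕ m r) (λ k → f (unflatten m r k)) ≡ sumFin m (λ i → sumFin (r i) (λ t → f (i , t)))
  sumFin-unflatten zero    r f = refl
  sumFin-unflatten (suc m) r f = trans (sumFin-++ (r Fin.zero) _ _)
    (cong₂ _+_ (sumFin-cong (r Fin.zero) (λ t → cong (f ∘ unflatten-⊎ m r) (Finₚ.splitAt-↑ˡ (r Fin.zero) t _)))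
               (trans (sumFin-cong _ (λ k → cong (f ∘ unflatten-⊎ m r) (Finₚ.splitAt-↑ʳ (r Fin.zero) _ k)))
                      (sumFin-unflatten m (λ i → r (Fin.suc i)) (λ (i , t) → f (Fin.suc i , t)))))

module ModPrime (p : ℕ) (p-prime : Prime p) where

  open Int using (_+_; _*_; _-_; -_; _^_; ∣_∣)
  open FiniteSums
  open import Data.Integer.Divisibility.Signed as ℤ∣ using (_∣_)
  open import Data.Nat.Primality using (prime⇒nonZero; prime⇒nonTrivial; prime⇒irreducible)
  import Data.Nat.Divisibility as ℕ∣
  open import Data.Nat.Coprimality using (Coprime; coprime-Bézout)
  open import Data.Nat.GCD using (module Bézout)
  open import Relation.Binary.Bundles using (Setoid)
  import Relation.Binary.Reasoning.Setoid as SetoidReasoning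

  instance
    p-nonZero : ℕ.NonZero p
    p-nonZero = prime⇒nonZero p-prime

  -- a record rather than a synonym for + p ∣ a - b, so that a and b remain inferable
  infix 4 _≈_ _≉_ _≈?_
  record _≈_ (a b : ℤ) : Set where
    constructor mk≈
    field divides : + p ∣ a - b

  _≉_ : ℤ → ℤ → Set
  a ≉ b = ¬ a ≈ b

  ≈⇒≡[mod] : ∀ {a b} → a ≈ b → a ≡[mod p ] b
  ≈⇒≡[mod] (mk≈ p∣a-b) = ℤ∣.∣⇒∣ᵤ p∣a-b

  ≡[mod]⇒≈ : ∀ {a b} → a ≡[mod p ] b → a ≈ b
  ≡[mod]⇒≈ p∣a-b = mk≈ (ℤ∣.∣ᵤ⇒∣ p∣a-b)

  ≈-reflexive : ∀ {a b} → a ≡ b → a ≈ b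
  ≈-reflexive {a} refl = mk≈ (subst (+ p ∣_) (sym (ℤₚ.+-inverseʳ a)) (ℤ∣.∣n⇒∣m*n (+ 0) ℤ∣.∣-refl))

  ≈-refl : ∀ {a} → a ≈ a
  ≈-refl = ≈-reflexive refl

  ≈-sym : ∀ {a b} → a ≈ b → b ≈ a
  ≈-sym {a} {b} (mk≈ p∣a-b) = mk≈ (subst (+ p ∣_) (swap a b) (ℤ∣.∣m⇒∣-m p∣a-b))
    where
    swap : ∀ a b → - (a - b) ≡ b - a
    swap = solve-∀

  ≈-trans : ∀ {a b c} → a ≈ b → b ≈ c → a ≈ c
  ≈-trans {a} {b} {c} (mk≈ p∣a-b) (mk≈ p∣b-c) = mk≈ (subst (+ p ∣_) (telescope a b c) (ℤ∣.∣m∣n⇒∣m+n p∣a-b p∣b-c))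
    where
    telescope : ∀ a b c → (a - b) + (b - c) ≡ a - c
    telescope = solve-∀

  ≈-setoid : Setoid _ _
  ≈-setoid = record { Carrier = ℤ ; _≈_ = _≈_
                    ; isEquivalence = record { refl = ≈-refl ; sym = ≈-sym ; trans = ≈-trans } }

  module ≈-Reasoning = SetoidReasoning ≈-setoid

  +-cong : ∀ {a b c d} → a ≈ b → c ≈ d → a + c ≈ b + d
  +-cong {a} {b} {c} {d} (mk≈ p∣a-b) (mk≈ p∣c-d) = mk≈ (subst (+ p ∣_) (regroup a b c d) (ℤ∣.∣m∣n⇒∣m+n p∣a-b p∣c-d))
    where
    regroup : ∀ a b c d → (a - b) + (c - d) ≡ (a + c) - (b + d)
    regroup = solve-∀

  -‿cong : ∀ {a b} → a ≈ b → - a ≈ - b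
  -‿cong {a} {b} (mk≈ p∣a-b) = mk≈ (subst (+ p ∣_) (regroup a b) (ℤ∣.∣m⇒∣-m p∣a-b))
    where
    regroup : ∀ a b → - (a - b) ≡ - a - - b
    regroup = solve-∀

  sub-cong : ∀ {a b c d} → a ≈ b → c ≈ d → a - c ≈ b - d
  sub-cong a≈b c≈d = +-cong a≈b (-‿cong c≈d)

  *-cong : ∀ {a b c d} → a ≈ b → c ≈ d → a * c ≈ b * d
  *-cong {a} {b} {c} {d} (mk≈ p∣a-b) (mk≈ p∣c-d) =
    mk≈ (subst (+ p ∣_) (regroup a b c d) (ℤ∣.∣m∣n⇒∣m+n (ℤ∣.∣m⇒∣m*n c p∣a-b) (ℤ∣.∣n⇒∣m*n b p∣c-d)))
    where
    regroup : ∀ a b c d → (a - b) * c + b * (c - d) ≡ a * c - b * d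
    regroup = solve-∀

  *p≈0 : ∀ z → z * + p ≈ + 0
  *p≈0 z = mk≈ (subst (+ p ∣_) (sym (ℤₚ.+-identityʳ (z * + p))) (ℤ∣.∣n⇒∣m*n z ℤ∣.∣-refl))

  -≈0⇒≈ : ∀ {a b} → a - b ≈ + 0 → a ≈ b
  -≈0⇒≈ {a} {b} (mk≈ p∣a-b-0) = mk≈ (subst (+ p ∣_) (ℤₚ.+-identityʳ (a - b)) p∣a-b-0)

  _≈?_ : ∀ a b → Dec (a ≈ b)
  a ≈? b = Relation.Nullary.Decidable.map′ mk≈ _≈_.divides (+ p ℤ∣.∣? (a - b))
    where import Relation.Nullary.Decidable

  ≈0⇒p∣ : ∀ {a} → a ≈ + 0 → p ℕ∣.∣ ∣ a ∣
  ≈0⇒p∣ {a} a≈0 = subst (λ z → p ℕ∣.∣ ∣ z ∣) (ℤₚ.+-identityʳ a) (≈⇒≡[mod] a≈0)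

  ¬1≈0 : + 1 ≉ + 0
  ¬1≈0 1≈0 = ℕ.nonTrivial⇒≢1 {{prime⇒nonTrivial p-prime}} (ℕ∣.∣1⇒≡1 (≈0⇒p∣ 1≈0))

  ≉0⇒coprime : ∀ m → + m ≉ + 0 → Coprime p m
  ≉0⇒coprime m m≉0 (d∣p , d∣m) with prime⇒irreducible p-prime d∣p
  ... | inj₁ d≡1  = d≡1
  ... | inj₂ refl = ⊥-elim (m≉0 (≡[mod]⇒≈ (subst (p ℕ∣.∣_) (cong ∣_∣ (sym (ℤₚ.+-identityʳ (+ m)))) d∣m)))

  private
    cast-Bézout : ∀ {a b c d} → a ℕ.+ b ℕ.* c ≡ d ℕ.* p → + a + + b * + c ≡ + d * + p
    cast-Bézout {a} {b} {c} {d} eq =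
      trans (sym (trans (ℤₚ.pos-+ a (b ℕ.* c)) (cong (_+_ (+ a)) (ℤₚ.pos-* b c))))
            (trans (cong +_ eq) (ℤₚ.pos-* d p))

  invertibleℕ : ∀ m → + m ≉ + 0 → ∃ λ b → + m * b ≈ + 1
  invertibleℕ m m≉0 with coprime-Bézout (≉0⇒coprime m m≉0)
  ... | Bézout.+- x y eq = - + y , mk≈ (subst (+ p ∣_) identity (ℤ∣.∣n⇒∣m*n (- + x) ℤ∣.∣-refl))
    where
    rearrange : ∀ y m → - (+ 1 + y * m) ≡ m * - y - + 1
    rearrange = solve-∀
    identity : - + x * + p ≡ + m * - + y - + 1
    identity = begin
      - + x * + p           ≡⟨ sym (ℤₚ.neg-distribˡ-* (+ x) (+ p)) ⟩
      - (+ x * + p)         ≡⟨ cong -_ (sym (cast-Bézout {1} {y} {m} {x} eq)) ⟩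
      - (+ 1 + + y * + m)   ≡⟨ rearrange (+ y) (+ m) ⟩
      + m * - + y - + 1     ∎
      where open ≡-Reasoning
  ... | Bézout.-+ x y eq = + y , mk≈ (subst (+ p ∣_) identity (ℤ∣.∣n⇒∣m*n (+ x) ℤ∣.∣-refl))
    where
    rearrange : ∀ x p → x * p ≡ + 1 + x * p - + 1
    rearrange = solve-∀
    identity : + x * + p ≡ + m * + y - + 1
    identity = begin
      + x * + p             ≡⟨ rearrange (+ x) (+ p) ⟩
      + 1 + + x * + p - + 1 ≡⟨ cong (_- + 1) (cast-Bézout′ eq) ⟩
      + m * + y - + 1       ∎
      where
      open ≡-Reasoning
      cast-Bézout′ : 1 ℕ.+ x ℕ.* p ≡ y ℕ.* m → + 1 + + x * + p ≡ + m * + y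
      cast-Bézout′ eq = trans (sym (trans (ℤₚ.pos-+ 1 (x ℕ.* p)) (cong (_+_ (+ 1)) (ℤₚ.pos-* x p))))
                              (trans (cong +_ eq) (trans (ℤₚ.pos-* y m) (ℤₚ.*-comm (+ y) (+ m))))

  invertible : ∀ a → a ≉ + 0 → ∃ λ b → a * b ≈ + 1
  invertible (+ m)    a≉0 = invertibleℕ m a≉0
  invertible -[1+ m ] a≉0 with invertibleℕ (suc m) (λ m≈0 → a≉0 (≈-trans (-‿cong m≈0) ≈-refl))
  ... | b , mb≈1 = - b , subst (_≈ + 1) (neg-*-neg (+ suc m) b) mb≈1
    where
    neg-*-neg : ∀ a b → a * b ≡ - a * - b
    neg-*-neg = solve-∀

  *≈0⇒≈0 : ∀ {a b} → a * b ≈ + 0 → a ≉ + 0 → b ≈ + 0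
  *≈0⇒≈0 {a} {b} ab≈0 a≉0 = begin
    b               ≈⟨ ≈-reflexive (sym (ℤₚ.*-identityˡ b)) ⟩
    + 1 * b         ≈⟨ *-cong (≈-sym a⁻¹-inverse) ≈-refl ⟩
    a * a⁻¹ * b     ≈⟨ ≈-reflexive (rearrange a b a⁻¹) ⟩
    a⁻¹ * (a * b)   ≈⟨ *-cong (≈-refl {a⁻¹}) ab≈0 ⟩
    a⁻¹ * + 0       ≈⟨ ≈-reflexive (ℤₚ.*-zeroʳ a⁻¹) ⟩
    + 0             ∎
    where
    open ≈-Reasoning
    a⁻¹ = proj₁ (invertible a a≉0)
    a⁻¹-inverse = proj₂ (invertible a a≉0)
    rearrange : ∀ a b c → a * c * b ≡ c * (a * b)
    rearrange = solve-∀

  *≉0 : ∀ {a b} → a ≉ + 0 → b ≉ + 0 → a * b ≉ + 0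
  *≉0 a≉0 b≉0 ab≈0 = b≉0 (*≈0⇒≈0 ab≈0 a≉0)

  residue : ∀ z → ∃ λ (c : Fin p) → z ≈ + toℕ c
  residue z = Fin.fromℕ< r<p , (begin
    z                         ≈⟨ ≈-reflexive (ℤ÷.a≡a%n+[a/n]*n z (+ p)) ⟩
    + r + (z ℤ÷./ + p) * + p  ≈⟨ +-cong (≈-refl {+ r}) (*p≈0 (z ℤ÷./ + p)) ⟩
    + r + + 0                 ≈⟨ ≈-reflexive (trans (ℤₚ.+-identityʳ (+ r)) (cong +_ (sym (Finₚ.toℕ-fromℕ< r<p)))) ⟩
    + toℕ (Fin.fromℕ< r<p)    ∎)
    where
    import Data.Integer.DivMod as ℤ÷
    open ≈-Reasoning
    r = z ℤ÷.% + p
    r<p = ℤ÷.n%d<d z (+ p)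

  open import Relation.Nullary.Decidable using (¬?; decidable-stable)
  open import Data.Vec.Functional using () renaming (_∷_ to _∷ᶠ_)

  sumFin-cong≈ : ∀ n {f g : Fin n → ℤ} → (∀ j → f j ≈ g j) → sumFin n f ≈ sumFin n g
  sumFin-cong≈ zero    f≈g = ≈-refl
  sumFin-cong≈ (suc n) f≈g = +-cong (f≈g Fin.zero) (sumFin-cong≈ n (λ j → f≈g (Fin.suc j)))

  sumFin≈0 : ∀ n {f : Fin n → ℤ} → (∀ j → f j ≈ + 0) → sumFin n f ≈ + 0
  sumFin≈0 n f≈0 = ≈-trans (sumFin-cong≈ n f≈0) (≈-reflexive (sumFin-zero n))

  linComb : ∀ {X : Set} a → (Fin a → ℤ) → (Fin a → X → ℤ) → X → ℤ
  linComb a α u x = sumFin a (λ j → α j * u j x)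

  Independent : ∀ {X : Set} a → (Fin a → X → ℤ) → Set
  Independent a u = ∀ α → (∀ x → linComb a α u x ≈ + 0) → ∀ j → α j ≈ + 0

  linComb-congʳ : ∀ {X : Set} a α (u w : Fin a → X → ℤ) x → (∀ j → u j x ≈ w j x) → linComb a α u x ≈ linComb a α w x
  linComb-congʳ a α u w x u≈w = sumFin-cong≈ a (λ j → *-cong (≈-refl {α j}) (u≈w j))

  linComb-congˡ : ∀ {X : Set} a {α β : Fin a → ℤ} (u : Fin a → X → ℤ) x → (∀ j → α j ≈ β j) → linComb a α u x ≈ linComb a β u x
  linComb-congˡ a u x α≈β = sumFin-cong≈ a (λ j → *-cong (α≈β j) (≈-refl {u j x}))

  linComb-zeroˡ : ∀ {X : Set} a (α : Fin a → ℤ) (u : Fin a → X → ℤ) x → (∀ j → α j ≈ + 0) → linComb a α u x ≈ + 0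
  linComb-zeroˡ a α u x α≈0 = sumFin≈0 a (λ j → ≈-trans (*-cong (α≈0 j) (≈-refl {u j x})) (≈-reflexive (ℤₚ.*-zeroˡ (u j x))))

  linComb-zeroʳ : ∀ {X : Set} a (α : Fin a → ℤ) (u : Fin a → X → ℤ) x → (∀ j → u j x ≈ + 0) → linComb a α u x ≈ + 0
  linComb-zeroʳ a α u x u≈0 = sumFin≈0 a (λ j → ≈-trans (*-cong (≈-refl {α j}) (u≈0 j)) (≈-reflexive (ℤₚ.*-zeroʳ (α j))))

  linComb-linComb : ∀ {X : Set} a b (α : Fin a → ℤ) (C : Fin a → Fin b → ℤ) (v : Fin b → X → ℤ) x →
    linComb a α (λ j → linComb b (C j) v) x ≡ linComb b (λ k → sumFin a (λ j → C j k * α j)) v x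
  linComb-linComb a b α C v x =
    trans (sumFin-cong a (λ j → sym (sumFin-*ˡ b (α j) _)))
    (trans (sumFin-comm a b _)
           (sumFin-cong b (λ k → trans (sumFin-cong a (λ j → rearrange (α j) (C j k) (v k x))) (sumFin-*ʳ a (v k x) _))))
    where
    rearrange : ∀ a c v → a * (c * v) ≡ (c * a) * v
    rearrange = solve-∀

  -- Gaussian elimination on the first column, pivoting on a row whose first entry is invertible
  more-unknowns⇒nontrivial-solution : ∀ a b → b < a → (R : Fin b → Fin a → ℤ) →
    ∃ λ (α : Fin a → ℤ) → (∃ λ j → α j ≉ + 0) × (∀ k → sumFin a (λ j → R k j * α j) ≈ + 0)
  more-unknowns⇒nontrivial-solution (suc a) b b<a R with Finₚ.any? (λ k → ¬? (R k Fin.zero ≈? + 0))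
  ... | no no-pivot = e₀ , (Fin.zero , ¬1≈0) , solves
    where
    e₀ : Fin (suc a) → ℤ
    e₀ Fin.zero    = + 1
    e₀ (Fin.suc _) = + 0
    solves : ∀ k → sumFin (suc a) (λ j → R k j * e₀ j) ≈ + 0
    solves k = +-cong (≈-trans (≈-reflexive (ℤₚ.*-identityʳ (R k Fin.zero)))
                               (decidable-stable (R k Fin.zero ≈? + 0) (λ R≉0 → no-pivot (k , R≉0))))
                      (sumFin≈0 a (λ j → ≈-reflexive (ℤₚ.*-zeroʳ (R k (Fin.suc j)))))
  more-unknowns⇒nontrivial-solution (suc a) (suc b) b<a R | yes (k₀ , c≉0) = α , (Fin.suc j₁ , β≉0) , solves
    where
    c = R k₀ Fin.zero
    c⁻¹ = proj₁ (invertible c c≉0)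
    row : Fin (suc b) → Fin a → ℤ
    row k j = R k (Fin.suc j)
    R′ : Fin b → Fin a → ℤ
    R′ k j = row (punchIn k₀ k) j - R (punchIn k₀ k) Fin.zero * c⁻¹ * row k₀ j
    β-solution = more-unknowns⇒nontrivial-solution a b (ℕₚ.≤-pred b<a) R′
    β = proj₁ β-solution
    j₁ = proj₁ (proj₁ (proj₂ β-solution))
    β≉0 = proj₂ (proj₁ (proj₂ β-solution))
    S = sumFin a (λ j → row k₀ j * β j)
    α : Fin (suc a) → ℤ
    α Fin.zero    = - (c⁻¹ * S)
    α (Fin.suc j) = β j
    solves-pivot : c * α Fin.zero + S ≈ + 0
    solves-pivot = ≈-trans (+-cong (≈-trans (≈-reflexive (rearrange c c⁻¹ S)) (-‿cong (*-cong (proj₂ (invertible c c≉0)) ≈-refl))) ≈-refl)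
                           (≈-reflexive (cancel S))
      where
      rearrange : ∀ c c⁻¹ S → c * - (c⁻¹ * S) ≡ - (c * c⁻¹ * S)
      rearrange = solve-∀
      cancel : ∀ S → - (+ 1 * S) + S ≡ + 0
      cancel = solve-∀
    solves-other : ∀ k′ → let k = punchIn k₀ k′ in R k Fin.zero * α Fin.zero + sumFin a (λ j → row k j * β j) ≈ + 0
    solves-other k′ = ≈-trans (≈-reflexive eliminated) (proj₂ (proj₂ β-solution) k′)
      where
      k = punchIn k₀ k′
      T = sumFin a (λ j → row k j * β j)
      eliminated : R k Fin.zero * - (c⁻¹ * S) + T ≡ sumFin a (λ j → R′ k′ j * β j)
      eliminated = sym (begin
        sumFin a (λ j → R′ k′ j * β j)
          ≡⟨ sumFin-cong a (λ j → expand (row k j) (row k₀ j) (β j) (R k Fin.zero * c⁻¹)) ⟩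
        sumFin a (λ j → row k j * β j + - (R k Fin.zero * c⁻¹ * (row k₀ j * β j)))
          ≡⟨ sumFin-distrib-+ a _ _ ⟩
        T + sumFin a (λ j → - (R k Fin.zero * c⁻¹ * (row k₀ j * β j)))
          ≡⟨ cong (_+_ T) (trans (sumFin-neg a _) (cong -_ (sumFin-*ˡ a (R k Fin.zero * c⁻¹) _))) ⟩
        T + - (R k Fin.zero * c⁻¹ * S)
          ≡⟨ collect (R k Fin.zero) c⁻¹ S T ⟩
        R k Fin.zero * - (c⁻¹ * S) + T ∎)
        where
        open ≡-Reasoning
        expand : ∀ a b d c → (a - c * b) * d ≡ a * d + - (c * (b * d))
        expand = solve-∀
        collect : ∀ r c⁻¹ S T → T + - (r * c⁻¹ * S) ≡ r * - (c⁻¹ * S) + T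
        collect = solve-∀
    solves : ∀ k → sumFin (suc a) (λ j → R k j * α j) ≈ + 0
    solves k with k₀ Finₚ.≟ k
    ... | yes refl = solves-pivot
    ... | no k₀≢k  = subst (λ k → sumFin (suc a) (λ j → R k j * α j) ≈ + 0) (Finₚ.punchIn-punchOut k₀≢k)
                           (solves-other (punchOut k₀≢k))

  steinitz : ∀ {X : Set} a b (u : Fin a → X → ℤ) (v : Fin b → X → ℤ) (C : Fin a → Fin b → ℤ) →
    Independent a u → (∀ j x → u j x ≈ linComb b (C j) v x) → a ≤ b
  steinitz a b u v C u-indep u∈span with a ℕ.≤? b
  ... | yes a≤b = a≤b
  ... | no  a≰b = ⊥-elim (α≉0 (u-indep α dependence j))
    where
    solution = more-unknowns⇒nontrivial-solution a b (ℕₚ.≰⇒> a≰b) (λ k j → C j k)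
    α = proj₁ solution
    j = proj₁ (proj₁ (proj₂ solution))
    α≉0 = proj₂ (proj₁ (proj₂ solution))
    dependence : ∀ x → linComb a α u x ≈ + 0
    dependence x = begin
      linComb a α u x                                          ≈⟨ linComb-congʳ a α u (λ j → linComb b (C j) v) x (λ j → u∈span j x) ⟩
      linComb a α (λ j → linComb b (C j) v) x                  ≈⟨ ≈-reflexive (linComb-linComb a b α C v x) ⟩
      linComb b (λ k → sumFin a (λ j → C j k * α j)) v x       ≈⟨ linComb-zeroˡ b _ v x (proj₂ (proj₂ solution)) ⟩
      + 0                                                      ∎
      where open ≈-Reasoning

  standard-independent : ∀ n → Independent n (λ j x → δ {n} j x)
  standard-independent n α combination≈0 j = ≈-trans (≈-reflexive (sym (sumFin-δ n α j))) (combination≈0 j)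

  independent⇒≤ : ∀ a N (u : Fin a → Fin N → ℤ) → Independent a u → a ≤ N
  independent⇒≤ a N u u-indep =
    steinitz a N u δ u u-indep (λ j x → ≈-reflexive (sym (sumFin-δ N (u j) x)))

  -- a property of coefficient vectors that respects ≈ is decided by searching the p^r residue vectors
  ∃-coefficients? : ∀ r (Q : (Fin r → ℤ) → Set) → (∀ γ → Dec (Q γ)) →
    (∀ γ γ′ → (∀ t → γ t ≈ γ′ t) → Q γ → Q γ′) → Dec (∃ Q)
  ∃-coefficients? zero Q Q? Q-resp with Q? (λ ())
  ... | yes q = yes ((λ ()) , q)
  ... | no ¬q = no (λ (γ , q) → ¬q (Q-resp γ (λ ()) (λ ()) q))
  ∃-coefficients? (suc r) Q Q? Q-resp
    with Finₚ.any? (λ c → ∃-coefficients? r (λ γ′ → Q ((+ toℕ c ∷ᶠ γ′))) (λ γ′ → Q? _)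
                           (λ γ γ′ γ≈γ′ → Q-resp _ _ (λ { Fin.zero → ≈-refl ; (Fin.suc t) → γ≈γ′ t })))
  ... | yes (c , γ′ , q) = yes (_ , q)
  ... | no ¬q = no (λ (γ , q) → ¬q (proj₁ (residue (γ Fin.zero)) , (λ t → γ (Fin.suc t)) ,
                     Q-resp γ _ (λ { Fin.zero → proj₂ (residue (γ Fin.zero)) ; (Fin.suc t) → ≈-refl }) q))

  record Basis {n : ℕ} (q : ℕ) (col : Fin q → Fin n → ℤ) : Set where
    field
      rank        : ℕ
      pick        : Fin rank → Fin q
      independent : Independent rank (λ t → col (pick t))
      coords      : Fin q → Fin rank → ℤ
      spans       : ∀ j x → col j x ≈ linComb rank (coords j) (λ t → col (pick t)) x

  private
    extend-basis : ∀ {n} q (col : Fin (suc q) → Fin n → ℤ) (B : Basis q (λ j → col (Fin.suc j))) →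
      let open Basis B in
      ¬ (∃ λ γ → ∀ x → col Fin.zero x ≈ linComb rank γ (λ t → col (Fin.suc (pick t))) x) →
      Basis (suc q) col
    extend-basis q col B col₀∉span = record
      { rank = suc rank ; pick = pick′ ; independent = independent′ ; coords = coords′ ; spans = spans′ }
      where
      open Basis B
      u = λ t → col (Fin.suc (pick t))
      pick′ : Fin (suc rank) → Fin (suc q)
      pick′ = Fin.zero ∷ᶠ (λ t → Fin.suc (pick t))
      coords′ : Fin (suc q) → Fin (suc rank) → ℤ
      coords′ Fin.zero    = + 1 ∷ᶠ (λ _ → + 0)
      coords′ (Fin.suc j) = + 0 ∷ᶠ coords j
      spans′ : ∀ j x → col j x ≈ linComb (suc rank) (coords′ j) (λ t → col (pick′ t)) x
      spans′ Fin.zero x = ≈-sym (≈-trans (+-cong (≈-reflexive (ℤₚ.*-identityˡ (col Fin.zero x)))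
                                                 (sumFin≈0 rank (λ t → ≈-reflexive (ℤₚ.*-zeroˡ (u t x)))))
                                         (≈-reflexive (ℤₚ.+-identityʳ _)))
      spans′ (Fin.suc j) x = ≈-trans (spans j x)
        (≈-sym (≈-trans (+-cong (≈-reflexive (ℤₚ.*-zeroˡ (col Fin.zero x))) (≈-refl {linComb rank (coords j) u x}))
                        (≈-reflexive (ℤₚ.+-identityˡ _))))
      -- a nonzero coefficient on col₀ would put col₀ in the span of the others
      independent′ : Independent (suc rank) (λ t → col (pick′ t))
      independent′ α combination≈0 = all-zero
        where
        rest : Fin rank → ℤ
        rest t = α (Fin.suc t)
        α₀≈0 : α Fin.zero ≈ + 0
        α₀≈0 = decidable-stable (α Fin.zero ≈? + 0) (λ α₀≉0 → col₀∉span (γ α₀≉0 , col₀∈span α₀≉0))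
          where
          γ : α Fin.zero ≉ + 0 → Fin rank → ℤ
          γ α₀≉0 t = - (proj₁ (invertible (α Fin.zero) α₀≉0) * rest t)
          col₀∈span : ∀ α₀≉0 x → col Fin.zero x ≈ linComb rank (γ α₀≉0) u x
          col₀∈span α₀≉0 x = begin
            col Fin.zero x                          ≈⟨ ≈-reflexive (sym (ℤₚ.*-identityˡ _)) ⟩
            + 1 * col Fin.zero x                    ≈⟨ *-cong (≈-sym (proj₂ (invertible (α Fin.zero) α₀≉0))) ≈-refl ⟩
            α Fin.zero * a⁻¹ * col Fin.zero x       ≈⟨ ≈-reflexive (rearrange (α Fin.zero) a⁻¹ (col Fin.zero x) L) ⟩
            a⁻¹ * (α Fin.zero * col Fin.zero x + L) - a⁻¹ * L ≈⟨ sub-cong (*-cong (≈-refl {a⁻¹}) (combination≈0 x)) (≈-refl {a⁻¹ * L}) ⟩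
            a⁻¹ * + 0 - a⁻¹ * L                     ≈⟨ ≈-reflexive (simplify a⁻¹ L) ⟩
            - (a⁻¹ * L)                             ≈⟨ ≈-reflexive (cong -_ (sym (sumFin-*ˡ rank a⁻¹ _))) ⟩
            - sumFin rank (λ t → a⁻¹ * (rest t * u t x)) ≈⟨ ≈-reflexive (sym (sumFin-neg rank _)) ⟩
            sumFin rank (λ t → - (a⁻¹ * (rest t * u t x))) ≈⟨ ≈-reflexive (sumFin-cong rank (λ t → reassociate a⁻¹ (rest t) (u t x))) ⟩
            linComb rank (γ α₀≉0) u x               ∎
            where
            open ≈-Reasoning
            a⁻¹ = proj₁ (invertible (α Fin.zero) α₀≉0)
            L = linComb rank rest u x
            rearrange : ∀ a b c L → a * b * c ≡ b * (a * c + L) - b * L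
            rearrange = solve-∀
            simplify : ∀ a L → a * + 0 - a * L ≡ - (a * L)
            simplify = solve-∀
            reassociate : ∀ a b c → - (a * (b * c)) ≡ - (a * b) * c
            reassociate = solve-∀
        rest≈0 : ∀ x → linComb rank rest u x ≈ + 0
        rest≈0 x = ≈-trans (≈-sym (≈-trans (+-cong (*-cong α₀≈0 (≈-refl {col Fin.zero x})) (≈-refl {linComb rank rest u x}))
                                            (≈-reflexive (trans (cong (_+ linComb rank rest u x) (ℤₚ.*-zeroˡ (col Fin.zero x)))
                                                                (ℤₚ.+-identityˡ _)))))
                           (combination≈0 x)
        all-zero : ∀ t → α t ≈ + 0
        all-zero Fin.zero    = α₀≈0
        all-zero (Fin.suc t) = independent rest rest≈0 t

  -- a basis is extracted greedily, keeping a column exactly when it is not in the span of the kept ones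
  basis : ∀ {n} q (col : Fin q → Fin n → ℤ) → Basis q col
  basis zero    col = record { rank = 0 ; pick = λ () ; independent = λ _ _ () ; coords = λ () ; spans = λ () }
  basis (suc q) col = keep-or-drop (∃-coefficients? rank (λ γ → ∀ x → col Fin.zero x ≈ linComb rank γ u x)
                                      (λ γ → Finₚ.all? (λ x → col Fin.zero x ≈? linComb rank γ u x))
                                      (λ γ γ′ γ≈γ′ in-span x → ≈-trans (in-span x) (linComb-congˡ rank u x γ≈γ′)))
    where
    B = basis q (λ j → col (Fin.suc j))
    open Basis B
    u = λ t → col (Fin.suc (pick t))
    keep-or-drop : Dec (∃ λ γ → ∀ x → col Fin.zero x ≈ linComb rank γ u x) → Basis (suc q) col
    keep-or-drop (yes (γ , col₀∈span)) = record
      { rank = rank ; pick = λ t → Fin.suc (pick t) ; independent = independent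
      ; coords = γ ∷ᶠ coords ; spans = λ { Fin.zero → col₀∈span ; (Fin.suc j) → spans j } }
    keep-or-drop (no col₀∉span) = extend-basis q col B col₀∉span

  open import Data.Vec.Functional using () renaming (_++_ to _++ᶠ_)
  open import Data.Vec.Functional.Properties using (lookup-++ˡ; lookup-++ʳ)

  ↑-elim : ∀ r s (P : Fin (r ℕ.+ s) → Set) → (∀ t → P (t ↑ˡ s)) → (∀ k → P (r ↑ʳ k)) → ∀ z → P z
  ↑-elim r s P left right z with splitAt r z in eq
  ... | inj₁ t = subst P (trans (cong (Fin.join r s) (sym eq)) (Finₚ.join-splitAt r s z)) (left t)
  ... | inj₂ k = subst P (trans (cong (Fin.join r s) (sym eq)) (Finₚ.join-splitAt r s z)) (right k)

  linComb-++ : ∀ {X : Set} r s α (f : Fin r → X → ℤ) (g : Fin s → X → ℤ) x →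
    linComb (r ℕ.+ s) α (f ++ᶠ g) x ≡ linComb r (λ t → α (t ↑ˡ s)) f x + linComb s (λ k → α (r ↑ʳ k)) g x
  linComb-++ r s α f g x = trans (sumFin-++ r s _)
    (cong₂ _+_ (sumFin-cong r (λ t → cong (λ v → α (t ↑ˡ s) * v x) (lookup-++ˡ f g t)))
               (sumFin-cong s (λ k → cong (λ v → α (r ↑ʳ k) * v x) (lookup-++ʳ f g k))))

  module _ {s n : ℕ} (M : Fin s → Fin n → ℤ) where

    columns : Fin n → Fin s → ℤ
    columns j x = M x j

    mulMV-zero : ∀ (v : Fin n → ℤ) → (∀ j → v j ≈ + 0) → ∀ k → mulMV M v k ≈ + 0
    mulMV-zero v v≈0 k = sumFin≈0 n (λ j → ≈-trans (*-cong (≈-refl {M k j}) (v≈0 j)) (≈-reflexive (ℤₚ.*-zeroʳ (M k j))))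

    mulMV-distrib-+ : ∀ (v w : Fin n → ℤ) k → mulMV M (λ j → v j + w j) k ≡ mulMV M v k + mulMV M w k
    mulMV-distrib-+ v w k = trans (sumFin-cong n (λ j → ℤₚ.*-distribˡ-+ (M k j) (v j) (w j))) (sumFin-distrib-+ n _ _)

    mulMV-distrib-- : ∀ (v w : Fin n → ℤ) k → mulMV M (λ j → v j - w j) k ≡ mulMV M v k - mulMV M w k
    mulMV-distrib-- v w k =
      trans (sumFin-cong n (λ j → distrib (M k j) (v j) (w j)))
            (trans (sumFin-distrib-+ n _ _) (cong (_+_ (mulMV M v k)) (sumFin-neg n _)))
      where
      distrib : ∀ m a b → m * (a - b) ≡ m * a + - (m * b)
      distrib = solve-∀

    mulMV-linComb : ∀ a (α : Fin a → ℤ) (G : Fin a → Fin n → ℤ) k →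
      mulMV M (linComb a α G) k ≡ linComb a α (λ t → mulMV M (G t)) k
    mulMV-linComb a α G k =
      trans (sumFin-cong n (λ j → sym (sumFin-*ˡ a (M k j) _)))
      (trans (sumFin-comm n a _)
             (sumFin-cong a (λ t → trans (sumFin-cong n (λ j → rearrange (M k j) (α t) (G t j))) (sumFin-*ˡ n (α t) _))))
      where
      rearrange : ∀ m a g → m * (a * g) ≡ a * (m * g)
      rearrange = solve-∀

    mulMV-δ : ∀ j x → mulMV M (λ j′ → δ j′ j) x ≡ columns j x
    mulMV-δ j x = sumFin-δ n (M x) j

    mulMV≡linComb-columns : ∀ w x → mulMV M w x ≡ linComb n w columns x
    mulMV≡linComb-columns w x = sumFin-cong n (λ j → ℤₚ.*-comm (M x j) (w j))

  record Cok (n : ℕ) (M : Fin n → Fin n → ℤ) (s : ℕ) : Set where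
    field
      φ           : Fin s → Fin n → ℤ
      surjective  : ∀ (y : Fin s → ℤ) → ∃ λ v → ∀ k → mulMV φ v k ≈ y k
      kernel⊆image : ∀ v → (∀ k → mulMV φ v k ≈ + 0) → ∃ λ w → ∀ k → mulMV M w k ≈ v k
      image⊆kernel : ∀ v w → (∀ k → mulMV M w k ≈ v k) → ∀ k → mulMV φ v k ≈ + 0

  CokIso⇒Cok : ∀ {n M s} → CokIso p n M s → Cok n M s
  CokIso⇒Cok (φ , surj , ker) = record
    { φ = φ
    ; surjective   = λ y → proj₁ (surj y) , λ k → ≡[mod]⇒≈ (proj₂ (surj y) k)
    ; kernel⊆image = λ v φv≈0 → let (w , Mw≡v) = proj₁ (ker v) (λ k → ≈⇒≡[mod] (φv≈0 k)) in w , λ k → ≡[mod]⇒≈ (Mw≡v k)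
    ; image⊆kernel = λ v w Mw≈v k → ≡[mod]⇒≈ (proj₂ (ker v) (w , λ k → ≈⇒≡[mod] (Mw≈v k)) k) }

  Cok⇒CokIso : ∀ {n M s} → Cok n M s → CokIso p n M s
  Cok⇒CokIso c = φ
    , (λ y → proj₁ (surjective y) , λ k → ≈⇒≡[mod] (proj₂ (surjective y) k))
    , λ v → (λ φv≡0 → let (w , Mw≈v) = kernel⊆image v (λ k → ≡[mod]⇒≈ (φv≡0 k)) in w , λ k → ≈⇒≡[mod] (Mw≈v k))
          , (λ (w , Mw≡v) k → ≈⇒≡[mod] (image⊆kernel v w (λ k → ≡[mod]⇒≈ (Mw≡v k)) k))
    where open Cok c

  Cok-resp-≈ : ∀ {n} {M M′ : Fin n → Fin n → ℤ} {s} → (∀ a c → M a c ≈ M′ a c) → Cok n M s → Cok n M′ s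
  Cok-resp-≈ {n} {M} {M′} M≈M′ ck = record
    { φ = φ ; surjective = surjective
    ; kernel⊆image = λ v φv≈0 → let (w , Mw≈v) = kernel⊆image v φv≈0 in w , λ k → ≈-trans (≈-sym (M≈M′w w k)) (Mw≈v k)
    ; image⊆kernel = λ v w M′w≈v → image⊆kernel v w (λ k → ≈-trans (M≈M′w w k) (M′w≈v k)) }
    where
    open Cok ck
    M≈M′w : ∀ w k → mulMV M w k ≈ mulMV M′ w k
    M≈M′w w k = sumFin-cong≈ n (λ j → *-cong (M≈M′ k j) (≈-refl {w j}))

  -- the picked columns of M together with lifts of the standard basis of F_p^s along φ form a basis of F_p^n
  module _ {n : ℕ} {M : Fin n → Fin n → ℤ} {s : ℕ} (ck : Cok n M s) (B : Basis n (columns M)) where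
    open Cok ck
    open Basis B renaming (independent to picked-independent)

    private
      picked : Fin rank → Fin n → ℤ
      picked t = columns M (pick t)

      lift : Fin s → Fin n → ℤ
      lift k = proj₁ (surjective (δ k))

      φ-lift : ∀ k k′ → mulMV φ (lift k) k′ ≈ δ k k′
      φ-lift k = proj₂ (surjective (δ k))

      φ-picked : ∀ t k → mulMV φ (picked t) k ≈ + 0
      φ-picked t = image⊆kernel (picked t) (λ j′ → δ j′ (pick t)) (λ k → ≈-reflexive (mulMV-δ M (pick t) k))

      family : Fin (rank ℕ.+ s) → Fin n → ℤ
      family = picked ++ᶠ lift

      family-independent : Independent (rank ℕ.+ s) family
      family-independent α combination≈0 = ↑-elim rank s (λ z → α z ≈ + 0) picked-part lift-part
        where
        αᵖ : Fin rank → ℤ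
        αᵖ t = α (t ↑ˡ s)
        αˡ : Fin s → ℤ
        αˡ k = α (rank ↑ʳ k)
        split : ∀ y → linComb (rank ℕ.+ s) α family y ≡ linComb rank αᵖ picked y + linComb s αˡ lift y
        split = linComb-++ rank s α picked lift
        -- applying φ kills the picked columns and turns the lifts into the standard basis
        lift-part : ∀ k′ → αˡ k′ ≈ + 0
        lift-part k′ = begin
          αˡ k′
            ≈⟨ ≈-reflexive (sym (sumFin-δ s αˡ k′)) ⟩
          linComb s αˡ δ k′
            ≈⟨ ≈-sym (linComb-congʳ s αˡ (λ k → mulMV φ (lift k)) δ k′ (λ k → φ-lift k k′)) ⟩
          linComb s αˡ (λ k → mulMV φ (lift k)) k′
            ≈⟨ ≈-sym (≈-trans (+-cong (linComb-zeroʳ rank αᵖ (λ t → mulMV φ (picked t)) k′ (λ t → φ-picked t k′)) ≈-refl)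
                              (≈-reflexive (ℤₚ.+-identityˡ _))) ⟩
          linComb rank αᵖ (λ t → mulMV φ (picked t)) k′ + linComb s αˡ (λ k → mulMV φ (lift k)) k′
            ≈⟨ ≈-reflexive (sym (cong₂ _+_ (mulMV-linComb φ rank αᵖ picked k′) (mulMV-linComb φ s αˡ lift k′))) ⟩
          mulMV φ (linComb rank αᵖ picked) k′ + mulMV φ (linComb s αˡ lift) k′
            ≈⟨ ≈-reflexive (sym (mulMV-distrib-+ φ _ _ k′)) ⟩
          mulMV φ (λ y → linComb rank αᵖ picked y + linComb s αˡ lift y) k′
            ≈⟨ mulMV-zero φ _ (λ y → ≈-trans (≈-reflexive (sym (split y))) (combination≈0 y)) k′ ⟩
          + 0 ∎
          where open ≈-Reasoning
        picked-part : ∀ t → αᵖ t ≈ + 0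
        picked-part = picked-independent αᵖ (λ x →
          ≈-trans (≈-sym (≈-trans (+-cong (≈-refl {linComb rank αᵖ picked x}) (linComb-zeroˡ s αˡ lift x lift-part))
                                  (≈-reflexive (ℤₚ.+-identityʳ _))))
                  (≈-trans (≈-reflexive (sym (split x))) (combination≈0 x)))

      -- e_j minus its φ-lift lies in ker φ = im M, hence in the span of the picked columns
      standard∈span : ∀ j → ∃ λ coeffs → ∀ x → δ j x ≈ linComb (rank ℕ.+ s) coeffs family x
      standard∈span j = (βᵖ ++ᶠ ψ) , λ x → begin
        δ j x                                               ≈⟨ ≈-reflexive (sym (cancel (δ j x) (linComb s ψ lift x))) ⟩
        residual x + linComb s ψ lift x                     ≈⟨ +-cong (≈-sym (Mw≈residual x)) ≈-refl ⟩
        mulMV M w x + linComb s ψ lift x                    ≈⟨ +-cong (≈-reflexive (mulMV≡linComb-columns M w x)) ≈-refl ⟩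
        linComb n w (columns M) x + linComb s ψ lift x
          ≈⟨ +-cong (linComb-congʳ n w (columns M) (λ j′ → linComb rank (coords j′) picked) x (λ j′ → spans j′ x)) ≈-refl ⟩
        linComb n w (λ j′ → linComb rank (coords j′) picked) x + linComb s ψ lift x
          ≈⟨ ≈-reflexive (cong (_+ linComb s ψ lift x) (linComb-linComb n rank w coords picked x)) ⟩
        linComb rank βᵖ picked x + linComb s ψ lift x
          ≈⟨ ≈-reflexive (sym (trans (linComb-++ rank s (βᵖ ++ᶠ ψ) picked lift x)
                                     (cong₂ _+_ (sumFin-cong rank (λ t → cong (_* picked t x) (lookup-++ˡ βᵖ ψ t)))
                                                (sumFin-cong s (λ k → cong (_* lift k x) (lookup-++ʳ βᵖ ψ k)))))) ⟩
        linComb (rank ℕ.+ s) (βᵖ ++ᶠ ψ) family x            ∎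
        where
        open ≈-Reasoning
        ψ : Fin s → ℤ
        ψ k = mulMV φ (δ j) k
        residual : Fin n → ℤ
        residual y = δ j y - linComb s ψ lift y
        φ-residual : ∀ k → mulMV φ residual k ≈ + 0
        φ-residual k = begin
          mulMV φ residual k                          ≈⟨ ≈-reflexive (mulMV-distrib-- φ (δ j) (linComb s ψ lift) k) ⟩
          ψ k - mulMV φ (linComb s ψ lift) k          ≈⟨ sub-cong (≈-refl {ψ k}) (≈-reflexive (mulMV-linComb φ s ψ lift k)) ⟩
          ψ k - linComb s ψ (λ k′ → mulMV φ (lift k′)) k
            ≈⟨ sub-cong (≈-refl {ψ k}) (linComb-congʳ s ψ (λ k′ → mulMV φ (lift k′)) δ k (λ k′ → φ-lift k′ k)) ⟩
          ψ k - linComb s ψ δ k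
            ≈⟨ ≈-reflexive (trans (cong (_-_ (ψ k)) (sumFin-δ s ψ k)) (ℤₚ.+-inverseʳ (ψ k))) ⟩
          + 0                                         ∎
        w = proj₁ (kernel⊆image residual φ-residual)
        Mw≈residual = proj₂ (kernel⊆image residual φ-residual)
        βᵖ : Fin rank → ℤ
        βᵖ t = sumFin n (λ j′ → coords j′ t * w j′)
        cancel : ∀ a b → a - b + b ≡ a
        cancel = solve-∀

    rank+corank≡n : rank ℕ.+ s ≡ n
    rank+corank≡n = ℕₚ.≤-antisym
      (independent⇒≤ (rank ℕ.+ s) n family family-independent)
      (steinitz n (rank ℕ.+ s) δ family (λ j → proj₁ (standard∈span j)) (standard-independent n)
                (λ j → proj₂ (standard∈span j)))

  HasDegree< : ℕ → (ℤ → ℤ) → Set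
  HasDegree< N f = ∃ λ (a : ℕ → ℤ) → ∀ z → f z ≡ sumℤ N (λ e → a e * z ^ e)

  HasDegree<-resp : ∀ {N f g} → (∀ z → f z ≡ g z) → HasDegree< N f → HasDegree< N g
  HasDegree<-resp f≗g (a , f≡) = a , λ z → trans (sym (f≗g z)) (f≡ z)

  HasDegree<-zero : HasDegree< 0 (λ _ → + 0)
  HasDegree<-zero = (λ _ → + 0) , λ _ → refl

  HasDegree<-const : ∀ c → HasDegree< 1 (λ _ → c)
  HasDegree<-const c = (λ _ → c) , λ _ → sym (trans (ℤₚ.+-identityˡ _) (ℤₚ.*-identityʳ c))

  HasDegree<-+ : ∀ {N f g} → HasDegree< N f → HasDegree< N g → HasDegree< N (λ z → f z + g z)
  HasDegree<-+ {N} (a , f≡) (b , g≡) = (λ e → a e + b e) , λ z →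
    trans (cong₂ _+_ (f≡ z) (g≡ z))
          (trans (sym (sumℤ-distrib-+ N _ _)) (sumℤ-cong N (λ e _ → sym (ℤₚ.*-distribʳ-+ (z ^ e) (a e) (b e)))))

  HasDegree<-scale : ∀ {N f} c → HasDegree< N f → HasDegree< N (λ z → c * f z)
  HasDegree<-scale {N} c (a , f≡) = (λ e → c * a e) , λ z →
    trans (cong (c *_) (f≡ z)) (trans (sym (sumℤ-*ˡ N c _)) (sumℤ-cong N (λ e _ → sym (ℤₚ.*-assoc c (a e) (z ^ e)))))

  HasDegree<-mono : ∀ {N N′ f} → N ≤ N′ → HasDegree< N f → HasDegree< N′ f
  HasDegree<-mono {N} {N′} {f} N≤N′ (a , f≡) = a′ , λ z → trans (f≡ z) (sym (padded z))
    where
    a′ : ℕ → ℤ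
    a′ e with e ℕ.<? N
    ... | yes _ = a e
    ... | no  _ = + 0
    a′-below : ∀ e → e < N → a′ e ≡ a e
    a′-below e e<N with e ℕ.<? N
    ... | yes _   = refl
    ... | no  e≮N = ⊥-elim (e≮N e<N)
    a′-above : ∀ e → a′ (N ℕ.+ e) ≡ + 0
    a′-above e with N ℕ.+ e ℕ.<? N
    ... | yes N+e<N = ⊥-elim (ℕₚ.m+n≮m N e N+e<N)
    ... | no  _     = refl
    padded : ∀ z → sumℤ N′ (λ e → a′ e * z ^ e) ≡ sumℤ N (λ e → a e * z ^ e)
    padded z = begin
      sumℤ N′ (λ e → a′ e * z ^ e)
        ≡⟨ cong (λ k → sumℤ k (λ e → a′ e * z ^ e)) (sym (ℕₚ.m+[n∸m]≡n N≤N′)) ⟩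
      sumℤ (N ℕ.+ (N′ ∸ N)) (λ e → a′ e * z ^ e)
        ≡⟨ sumℤ-++ N (N′ ∸ N) _ ⟩
      sumℤ N (λ e → a′ e * z ^ e) + sumℤ (N′ ∸ N) (λ e → a′ (N ℕ.+ e) * z ^ (N ℕ.+ e))
        ≡⟨ cong₂ _+_ (sumℤ-cong N (λ e e<N → cong (_* z ^ e) (a′-below e e<N)))
                     (trans (sumℤ-cong (N′ ∸ N) (λ e _ → trans (cong (_* z ^ (N ℕ.+ e)) (a′-above e)) (ℤₚ.*-zeroˡ (z ^ (N ℕ.+ e)))))
                            (sumℤ-zero (N′ ∸ N))) ⟩
      sumℤ N (λ e → a e * z ^ e) + + 0
        ≡⟨ ℤₚ.+-identityʳ _ ⟩
      sumℤ N (λ e → a e * z ^ e) ∎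
      where open ≡-Reasoning

  HasDegree<-*X : ∀ {N f} → HasDegree< N f → HasDegree< (suc N) (λ z → z * f z)
  HasDegree<-*X {N} (a , f≡) = shifted , λ z → begin
    z * _                                  ≡⟨ cong (z *_) (f≡ z) ⟩
    z * sumℤ N (λ e → a e * z ^ e)         ≡⟨ sym (sumℤ-*ˡ N z _) ⟩
    sumℤ N (λ e → z * (a e * z ^ e))       ≡⟨ sumℤ-cong N (λ e _ → rearrange (a e) z (z ^ e)) ⟩
    sumℤ N (λ e → a e * z ^ suc e)         ≡⟨ sym (ℤₚ.+-identityˡ _) ⟩
    + 0 + sumℤ N (λ e → a e * z ^ suc e)   ≡⟨ cong (_+ sumℤ N (λ e → a e * z ^ suc e)) (sym (ℤₚ.*-zeroˡ (z ^ 0))) ⟩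
    shifted 0 * z ^ 0 + sumℤ N (λ e → shifted (suc e) * z ^ suc e) ≡⟨ sym (sumℤ-head N _) ⟩
    sumℤ (suc N) (λ e → shifted e * z ^ e) ∎
    where
    open ≡-Reasoning
    shifted : ℕ → ℤ
    shifted zero    = + 0
    shifted (suc e) = a e
    rearrange : ∀ a z w → z * (a * w) ≡ a * (z * w)
    rearrange = solve-∀

  HasDegree<-sum : ∀ {N} k (f : Fin k → ℤ → ℤ) → (∀ i → HasDegree< N (f i)) → HasDegree< N (λ z → sumFin k (λ i → f i z))
  HasDegree<-sum {N} zero f f-deg = HasDegree<-mono {0} {N} z≤n HasDegree<-zero
  HasDegree<-sum {N} (suc k) f f-deg = HasDegree<-+ {N} (f-deg Fin.zero) (HasDegree<-sum {N} k (λ i → f (Fin.suc i)) (λ i → f-deg (Fin.suc i)))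

  HasDegree<-split : ∀ {N f} → HasDegree< (suc N) f →
    ∃ λ f₀ → ∃ λ f′ → HasDegree< N f′ × (∀ z → f z ≡ f₀ + z * f′ z)
  HasDegree<-split {N} (a , f≡) = a 0 , f′ , ((λ e → a (suc e)) , λ _ → refl) , λ z →
    trans (f≡ z) (trans (sumℤ-head N _) (cong₂ _+_ (ℤₚ.*-identityʳ (a 0))
      (trans (sumℤ-cong N (λ e _ → rearrange (a (suc e)) z (z ^ e))) (sumℤ-*ˡ N z _))))
    where
    f′ = λ z → sumℤ N (λ e → a (suc e) * z ^ e)
    rearrange : ∀ a z w → a * (z * w) ≡ z * (a * w)
    rearrange = solve-∀

  HasDegree<1⇒constant : ∀ {f} → HasDegree< 1 f → ∀ z w → f z ≡ f w
  HasDegree<1⇒constant (a , f≡) z w = trans (f≡ z) (sym (f≡ w))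

  HasDegree<-* : ∀ a b {f g} → HasDegree< (suc a) f → HasDegree< b g → HasDegree< (a ℕ.+ b) (λ z → f z * g z)
  HasDegree<-* zero b {f} {g} f-deg g-deg =
    HasDegree<-resp {b} (λ z → cong (_* g z) (HasDegree<1⇒constant f-deg (+ 0) z)) (HasDegree<-scale {b} (f (+ 0)) g-deg)
  HasDegree<-* (suc a) b {f} {g} f-deg g-deg with HasDegree<-split {suc a} f-deg
  ... | f₀ , f′ , f′-deg , f≡ = HasDegree<-resp {suc a ℕ.+ b} (λ z → sym (trans (cong (_* g z) (f≡ z)) (distrib f₀ z (f′ z) (g z))))
        (HasDegree<-+ {suc a ℕ.+ b} (HasDegree<-mono {b} (ℕₚ.m≤n+m b (suc a)) (HasDegree<-scale {b} f₀ g-deg))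
                                    (HasDegree<-*X {a ℕ.+ b} (HasDegree<-* a b f′-deg g-deg)))
    where
    distrib : ∀ c z f g → (c + z * f) * g ≡ c * g + z * (f * g)
    distrib = solve-∀

  HasDegree<-linear : ∀ c → HasDegree< 2 (λ z → z - c)
  HasDegree<-linear c =
    HasDegree<-resp {2} (λ z → simplify z c)
      (HasDegree<-+ {2} (HasDegree<-*X {1} (HasDegree<-const (+ 1))) (HasDegree<-mono {1} {2} (s≤s z≤n) (HasDegree<-const (- c))))
    where
    simplify : ∀ z c → z * + 1 + - c ≡ z - c
    simplify = solve-∀

  HasDegree<-^ : ∀ c h → HasDegree< (suc h) (λ z → (z - c) ^ h)
  HasDegree<-^ c zero    = HasDegree<-const (+ 1)
  HasDegree<-^ c (suc h) = HasDegree<-* 1 (suc h) (HasDegree<-linear c) (HasDegree<-^ c h)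

  factor-theorem : ∀ N c {f} → HasDegree< (suc N) f → ∃ λ q → HasDegree< N q × (∀ z → f z ≡ (z - c) * q z + f c)
  factor-theorem zero c {f} f-deg = (λ _ → + 0) , HasDegree<-zero , λ z →
    trans (HasDegree<1⇒constant f-deg z c)
          (sym (trans (cong (_+ f c) (ℤₚ.*-zeroʳ (z - c))) (ℤₚ.+-identityˡ (f c))))
  factor-theorem (suc N) c {f} f-deg with HasDegree<-split {suc N} f-deg
  ... | f₀ , f′ , f′-deg , f≡ with factor-theorem N c f′-deg
  ...   | q′ , q′-deg , f′≡ = (λ z → z * q′ z + f′ c)
      , HasDegree<-+ {suc N} (HasDegree<-*X {N} q′-deg) (HasDegree<-mono {1} {suc N} (s≤s z≤n) (HasDegree<-const (f′ c)))
      , λ z → begin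
          f z                                         ≡⟨ f≡ z ⟩
          f₀ + z * f′ z                               ≡⟨ cong (λ w → f₀ + z * w) (f′≡ z) ⟩
          f₀ + z * ((z - c) * q′ z + f′ c)            ≡⟨ regroup f₀ z c (q′ z) (f′ c) ⟩
          (z - c) * (z * q′ z + f′ c) + (f₀ + c * f′ c) ≡⟨ cong (_+_ ((z - c) * (z * q′ z + f′ c))) (sym (f≡ c)) ⟩
          (z - c) * (z * q′ z + f′ c) + f c           ∎
    where
    open ≡-Reasoning
    regroup : ∀ f₀ z c Q F → f₀ + z * ((z - c) * Q + F) ≡ (z - c) * (z * Q + F) + (f₀ + c * F)
    regroup = solve-∀

  -- factor theorem plus the absence of zero divisors in ℤ/p
  roots⇒≈0 : ∀ N {f} → HasDegree< N f → (ys : Fin N → ℤ) → (∀ i j → ys i ≈ ys j → i ≡ j) →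
    (∀ i → f (ys i) ≈ + 0) → ∀ z → f z ≈ + 0
  roots⇒≈0 zero    (a , f≡) ys ys-distinct f-roots z = ≈-reflexive (f≡ z)
  roots⇒≈0 (suc N) {f} f-deg ys ys-distinct f-roots z with factor-theorem N (ys Fin.zero) f-deg
  ... | q , q-deg , f≡ = begin
    f z                    ≈⟨ ≈-reflexive (f≡ z) ⟩
    (z - c) * q z + f c    ≈⟨ +-cong (*-cong (≈-refl {z - c}) (q≈0 z)) (f-roots Fin.zero) ⟩
    (z - c) * + 0 + + 0    ≈⟨ ≈-reflexive (trans (ℤₚ.+-identityʳ _) (ℤₚ.*-zeroʳ (z - c))) ⟩
    + 0                    ∎
    where
    open ≈-Reasoning
    c = ys Fin.zero
    q-roots : ∀ i → q (ys (Fin.suc i)) ≈ + 0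
    q-roots i = *≈0⇒≈0 (begin
      (y - c) * q y                ≈⟨ ≈-reflexive (add-sub ((y - c) * q y) (f c)) ⟩
      (y - c) * q y + f c - f c    ≈⟨ ≈-reflexive (cong (_- f c) (sym (f≡ y))) ⟩
      f y - f c                    ≈⟨ sub-cong (f-roots (Fin.suc i)) (f-roots Fin.zero) ⟩
      + 0                          ∎) y≉c
      where
      y = ys (Fin.suc i)
      add-sub : ∀ a b → a ≡ a + b - b
      add-sub = solve-∀
      y≉c : y - c ≉ + 0
      y≉c y-c≈0 = Finₚ.0≢1+n (sym (ys-distinct (Fin.suc i) Fin.zero (-≈0⇒≈ y-c≈0)))
    q≈0 : ∀ z → q z ≈ + 0
    q≈0 = roots⇒≈0 N q-deg (λ i → ys (Fin.suc i)) (λ i j yᵢ≈yⱼ → Finₚ.suc-injective (ys-distinct _ _ yᵢ≈yⱼ)) q-roots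

  evalMatPoly : ∀ {n} l → (ℕ → Fin n → Fin n → ℤ) → ℤ → Fin n → Fin n → ℤ
  evalMatPoly l B z a c = sumℤ (suc l) (λ j → B j a c * z ^ j)

  HasDegree<-evalMatPoly : ∀ {n} l (B : ℕ → Fin n → Fin n → ℤ) a c → HasDegree< (suc l) (λ z → evalMatPoly l B z a c)
  HasDegree<-evalMatPoly l B a c = (λ j → B j a c) , λ _ → refl

  -- the terms p^(j-l) t^j A_j with j > l vanish mod p
  redEvalIntegral≈evalMatPoly : ∀ l r n (A : ℕ → MatZp p n) (x : Zp p) a c →
    redEvalIntegral p l r n A x a c ≈ evalMatPoly l (λ j a c → seq (A j a c) 1) (seq x 1) a c
  redEvalIntegral≈evalMatPoly l r n A x a c = begin
    sumℤ (suc l ℕ.+ r) term                                         ≈⟨ ≈-reflexive (sumℤ-++ (suc l) r term) ⟩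
    sumℤ (suc l) term + sumℤ r (λ j → term (suc l ℕ.+ j))           ≈⟨ +-cong (≈-reflexive low-terms) high-terms ⟩
    evalMatPoly l (λ j a c → seq (A j a c) 1) (seq x 1) a c + + 0   ≈⟨ ≈-reflexive (ℤₚ.+-identityʳ _) ⟩
    evalMatPoly l (λ j a c → seq (A j a c) 1) (seq x 1) a c         ∎
    where
    open ≈-Reasoning
    term : ℕ → ℤ
    term j = ((+ p) ^ (j ∸ l)) * seq (A j a c) 1 * (seq x 1 ^ j)
    low-terms : sumℤ (suc l) term ≡ evalMatPoly l (λ j a c → seq (A j a c) 1) (seq x 1) a c
    low-terms = sumℤ-cong (suc l) (λ j j≤l →
      trans (cong (λ e → (+ p) ^ e * seq (A j a c) 1 * (seq x 1 ^ j)) (ℕₚ.m≤n⇒m∸n≡0 (ℕₚ.≤-pred j≤l)))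
            (cong (_* (seq x 1 ^ j)) (ℤₚ.*-identityˡ (seq (A j a c) 1))))
    high-term : ∀ j → term (suc l ℕ.+ j) ≈ + 0
    high-term j = ≈-trans (≈-reflexive (trans (cong (λ e → (+ p) ^ e * Aⱼ * xʲ) exponent) (rearrange (+ p) ((+ p) ^ j) Aⱼ xʲ)))
                          (*p≈0 ((+ p) ^ j * Aⱼ * xʲ))
      where
      Aⱼ = seq (A (suc l ℕ.+ j) a c) 1
      xʲ = seq x 1 ^ (suc l ℕ.+ j)
      exponent : suc l ℕ.+ j ∸ l ≡ suc j
      exponent = trans (cong (_∸ l) (sym (ℕₚ.+-suc l j))) (ℕₚ.m+n∸m≡n l (suc j))
      rearrange : ∀ k Y X w → k * Y * X * w ≡ (Y * X * w) * k
      rearrange = solve-∀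
    high-terms : sumℤ r (λ j → term (suc l ℕ.+ j)) ≈ + 0
    high-terms = ≈-trans (sumℤ-cong≈ r (λ j _ → high-term j)) (≈-reflexive (sumℤ-zero r))
      where
      sumℤ-cong≈ : ∀ n {f g : ℕ → ℤ} → (∀ j → j < n → f j ≈ g j) → sumℤ n f ≈ sumℤ n g
      sumℤ-cong≈ zero    f≈g = ≈-refl
      sumℤ-cong≈ (suc n) f≈g = +-cong (sumℤ-cong≈ n (λ j j<n → f≈g j (ℕₚ.m<n⇒m<1+n j<n))) (f≈g n ℕₚ.≤-refl)


  module RankInequality (l : ℕ) {m′ n : ℕ} (B : ℕ → Fin n → Fin n → ℤ)
    (ys : Fin (suc m′) → ℤ) (ys-distinct : ∀ i j → ys i ≈ ys j → i ≡ j) where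

    Q : Fin (suc m′) → Fin n → Fin n → ℤ
    Q i = evalMatPoly l B (ys i)

    bases : ∀ i → Basis n (columns (Q i))
    bases i = basis n (columns (Q i))

    rank : Fin (suc m′) → ℕ
    rank i = Basis.rank (bases i)

    module _ (i₀ : Fin (suc m′)) where

      private
        y₀ = ys i₀
        r₀ = rank i₀
        J₀ = Basis.pick (bases i₀)

      shiftedPoly : ∀ d → (Fin d → Fin r₀ → ℤ) → Fin r₀ → ℤ → ℤ
      shiftedPoly d α t z = sumFin d (λ h → α h t * (z - y₀) ^ toℕ h)

      combination : ∀ d → (Fin d → Fin r₀ → ℤ) → Fin n → ℤ → ℤ
      combination d α x z = sumFin r₀ (λ t → evalMatPoly l B z x (J₀ t) * shiftedPoly d α t z)

      HasDegree<-combination : ∀ d α x → HasDegree< (l ℕ.+ d) (combination d α x)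
      HasDegree<-combination d α x = HasDegree<-sum {l ℕ.+ d} r₀ _ (λ t →
        HasDegree<-* l d (HasDegree<-evalMatPoly l B x (J₀ t))
          (HasDegree<-sum {d} d _ (λ h → HasDegree<-mono {suc (toℕ h)} (Finₚ.toℕ<n h)
                                           (HasDegree<-scale {suc (toℕ h)} (α h t) (HasDegree<-^ y₀ (toℕ h))))))

      shiftedPoly-suc : ∀ d α t z →
        shiftedPoly (suc d) α t z ≡ α Fin.zero t + (z - y₀) * shiftedPoly d (λ h → α (Fin.suc h)) t z
      shiftedPoly-suc d α t z = cong₂ _+_ (ℤₚ.*-identityʳ (α Fin.zero t))
        (trans (sumFin-cong d (λ h → rearrange (α (Fin.suc h) t) (z - y₀) ((z - y₀) ^ toℕ h)))
               (sumFin-*ˡ d (z - y₀) _))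
        where
        rearrange : ∀ a w v → a * (w * v) ≡ w * (a * v)
        rearrange = solve-∀

      shiftedPoly-y₀ : ∀ d α t → shiftedPoly (suc d) α t y₀ ≡ α Fin.zero t
      shiftedPoly-y₀ d α t = trans (shiftedPoly-suc d α t y₀)
        (trans (cong (λ w → α Fin.zero t + w * shiftedPoly d (λ h → α (Fin.suc h)) t y₀) (ℤₚ.+-inverseʳ y₀))
               (ℤₚ.+-identityʳ (α Fin.zero t)))

      -- independence at y₀ kills the constant coefficients; dividing by z - y₀ leaves fewer
      -- coefficients and the roots at the other points, so the polynomial vanishes and we recurse
      combination≈0⇒α≈0 : ∀ d → d ℕ.+ l ≤ suc m′ → ∀ α → (∀ x z → combination d α x z ≈ + 0) → ∀ h t → α h t ≈ + 0
      combination≈0⇒α≈0 zero    d+l≤m α combination≈0 ()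
      combination≈0⇒α≈0 (suc d) d+l≤m α combination≈0 = all-zero
        where
        α′ : Fin d → Fin r₀ → ℤ
        α′ h = α (Fin.suc h)
        α₀≈0 : ∀ t → α Fin.zero t ≈ + 0
        α₀≈0 = Basis.independent (bases i₀) (α Fin.zero) (λ x →
          ≈-trans (≈-reflexive (sumFin-cong r₀ (λ t →
                     trans (ℤₚ.*-comm (α Fin.zero t) _) (cong (evalMatPoly l B y₀ x (J₀ t) *_) (sym (shiftedPoly-y₀ d α t))))))
                  (combination≈0 x y₀))
        factored : ∀ x z → combination (suc d) α x z ≈ (z - y₀) * combination d α′ x z
        factored x z = ≈-trans
          (sumFin-cong≈ r₀ (λ t → *-cong (≈-refl {evalMatPoly l B z x (J₀ t)})
            (≈-trans (≈-reflexive (shiftedPoly-suc d α t z))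
                     (≈-trans (+-cong (α₀≈0 t) ≈-refl) (≈-reflexive (ℤₚ.+-identityˡ _))))))
          (≈-reflexive (trans (sumFin-cong r₀ (λ t → rearrange (evalMatPoly l B z x (J₀ t)) (z - y₀) (shiftedPoly d α′ t z)))
                              (sumFin-*ˡ r₀ (z - y₀) _)))
          where
          rearrange : ∀ a w v → a * (w * v) ≡ w * (a * v)
          rearrange = solve-∀
        l+d≤m′ : l ℕ.+ d ≤ m′
        l+d≤m′ = ℕₚ.≤-trans (ℕₚ.≤-reflexive (ℕₚ.+-comm l d)) (ℕₚ.≤-pred d+l≤m)
        others : Fin (l ℕ.+ d) → ℤ
        others k = ys (punchIn i₀ (Fin.inject≤ k l+d≤m′))
        others-distinct : ∀ a b → others a ≈ others b → a ≡ b
        others-distinct a b oa≈ob = Finₚ.inject≤-injective l+d≤m′ l+d≤m′ a b (Finₚ.punchIn-injective i₀ _ _ (ys-distinct _ _ oa≈ob))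
        others-roots : ∀ x k → combination d α′ x (others k) ≈ + 0
        others-roots x k = *≈0⇒≈0 (≈-trans (≈-sym (factored x (others k))) (combination≈0 x (others k))) y≉y₀
          where
          y≉y₀ : others k - y₀ ≉ + 0
          y≉y₀ y-y₀≈0 = Finₚ.punchInᵢ≢i i₀ (Fin.inject≤ k l+d≤m′) (ys-distinct _ _ (-≈0⇒≈ y-y₀≈0))
        all-zero : ∀ h t → α h t ≈ + 0
        all-zero Fin.zero    = α₀≈0
        all-zero (Fin.suc h) = combination≈0⇒α≈0 d (ℕₚ.≤-trans (ℕₚ.n≤1+n _) d+l≤m) α′
          (λ x → roots⇒≈0 (l ℕ.+ d) (HasDegree<-combination d α′ x) others others-distinct (others-roots x)) h

      roots⇒α≈0 : ∀ d → d ℕ.+ l ≤ suc m′ → ∀ α → (∀ x i → combination d α x (ys i) ≈ + 0) → ∀ h t → α h t ≈ + 0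
      roots⇒α≈0 d d+l≤m α roots = combination≈0⇒α≈0 d d+l≤m α (λ x →
        roots⇒≈0 (l ℕ.+ d) (HasDegree<-combination d α x) points points-distinct (λ k → roots x _))
        where
        l+d≤m : l ℕ.+ d ≤ suc m′
        l+d≤m = ℕₚ.≤-trans (ℕₚ.≤-reflexive (ℕₚ.+-comm l d)) d+l≤m
        points : Fin (l ℕ.+ d) → ℤ
        points k = ys (Fin.inject≤ k l+d≤m)
        points-distinct : ∀ a b → points a ≈ points b → a ≡ b
        points-distinct a b pa≈pb = Finₚ.inject≤-injective l+d≤m l+d≤m a b (ys-distinct _ _ pa≈pb)

      -- the d r₀ vectors (i , y) ↦ (yᵢ - y₀)^h Q(yᵢ)_{y, J₀ t} are independent
      -- and lie in the direct sum of the column spaces of the Q(yᵢ)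
      rank-inequality : l ≤ suc m′ → (suc m′ ∸ l) ℕ.* r₀ ≤ sumFinℕ (suc m′) rank
      rank-inequality l≤m = subst (_≤ sumFinℕ (suc m′) rank) (sumFinℕ-const d r₀) (steinitz _ _ u Z C u-independent u∈span)
        where
        d = suc m′ ∸ l
        X = Fin (suc m′) × Fin n
        Src = Σ (Fin d) (λ _ → Fin r₀)
        Tgt = Σ (Fin (suc m′)) (λ i → Fin (rank i))
        pickₜ : (it : Tgt) → Fin n
        pickₜ (i , t) = Basis.pick (bases i) t
        u′ : Src → X → ℤ
        u′ (h , t) (i , y) = (ys i - y₀) ^ toℕ h * Q i y (J₀ t)
        Z′ : Tgt → X → ℤ
        Z′ (i′ , t′) (i , y) = Q i′ y (pickₜ (i′ , t′)) * δ i′ i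
        C′ : Src → Tgt → ℤ
        C′ (h , t) (i′ , t′) = (ys i′ - y₀) ^ toℕ h * Basis.coords (bases i′) (J₀ t) t′
        u : Fin (sumFinℕ d (λ _ → r₀)) → X → ℤ
        u k = u′ (unflatten d (λ _ → r₀) k)
        Z : Fin (sumFinℕ (suc m′) rank) → X → ℤ
        Z k = Z′ (unflatten (suc m′) rank k)
        C : Fin (sumFinℕ d (λ _ → r₀)) → Fin (sumFinℕ (suc m′) rank) → ℤ
        C k k′ = C′ (unflatten d (λ _ → r₀) k) (unflatten (suc m′) rank k′)
        u∈span : ∀ k x → u k x ≈ linComb _ (C k) Z x
        u∈span k (i , y) = ≈-trans (*-cong (≈-refl {(ys i - y₀) ^ toℕ h}) (Basis.spans (bases i) (J₀ t) y))
                                   (≈-reflexive (sym expand))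
          where
          hk = unflatten d (λ _ → r₀) k
          h = proj₁ hk
          t = proj₂ hk
          V : Fin (suc m′) → ℤ
          V i′ = sumFin (rank i′) (λ t′ → C′ hk (i′ , t′) * Q i′ y (pickₜ (i′ , t′)))
          expand : linComb _ (C k) Z (i , y)
                 ≡ (ys i - y₀) ^ toℕ h * linComb (rank i) (Basis.coords (bases i) (J₀ t)) (λ t′ y′ → Q i y′ (pickₜ (i , t′))) y
          expand = begin
            linComb _ (C k) Z (i , y)
              ≡⟨ sumFin-unflatten (suc m′) rank (λ it → C′ hk it * Z′ it (i , y)) ⟩
            sumFin (suc m′) (λ i′ → sumFin (rank i′) (λ t′ → C′ hk (i′ , t′) * Z′ (i′ , t′) (i , y)))
              ≡⟨ sumFin-cong (suc m′) (λ i′ → trans (sumFin-cong (rank i′) (λ t′ → sym (ℤₚ.*-assoc (C′ hk (i′ , t′)) _ (δ i′ i))))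
                                                    (sumFin-*ʳ (rank i′) (δ i′ i) (λ t′ → C′ hk (i′ , t′) * Q i′ y (pickₜ (i′ , t′))))) ⟩
            sumFin (suc m′) (λ i′ → V i′ * δ i′ i)
              ≡⟨ sumFin-δ (suc m′) V i ⟩
            V i
              ≡⟨ trans (sumFin-cong (rank i) (λ t′ → ℤₚ.*-assoc ((ys i - y₀) ^ toℕ h) _ _)) (sumFin-*ˡ (rank i) ((ys i - y₀) ^ toℕ h) _) ⟩
            (ys i - y₀) ^ toℕ h * linComb (rank i) (Basis.coords (bases i) (J₀ t)) (λ t′ y′ → Q i y′ (pickₜ (i , t′))) y ∎
            where open ≡-Reasoning
        u-independent : Independent _ u
        u-independent α combination≈0 k =
          subst (λ k → α k ≈ + 0) (flatten-unflatten d (λ _ → r₀) k)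
                (roots⇒α≈0 d d+l≤m α̃ (λ y i → ≈-trans (≈-reflexive (as-linComb y i)) (combination≈0 (i , y))) _ _)
          where
          d+l≤m : d ℕ.+ l ≤ suc m′
          d+l≤m = ℕₚ.≤-reflexive (ℕₚ.m∸n+n≡m l≤m)
          α̃ : Fin d → Fin r₀ → ℤ
          α̃ h t = α (flatten d (λ _ → r₀) (h , t))
          as-linComb : ∀ y i → combination d α̃ y (ys i) ≡ linComb _ α u (i , y)
          as-linComb y i = begin
            combination d α̃ y (ys i)
              ≡⟨ sumFin-cong r₀ (λ t → sym (sumFin-*ˡ d (Q i y (J₀ t)) _)) ⟩
            sumFin r₀ (λ t → sumFin d (λ h → Q i y (J₀ t) * (α̃ h t * (ys i - y₀) ^ toℕ h)))
              ≡⟨ sumFin-comm r₀ d _ ⟩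
            sumFin d (λ h → sumFin r₀ (λ t → Q i y (J₀ t) * (α̃ h t * (ys i - y₀) ^ toℕ h)))
              ≡⟨ sumFin-cong d (λ h → sumFin-cong r₀ (λ t → rearrange (Q i y (J₀ t)) (α̃ h t) ((ys i - y₀) ^ toℕ h))) ⟩
            sumFin d (λ h → sumFin r₀ (λ t → α̃ h t * u′ (h , t) (i , y)))
              ≡⟨ sym (sumFin-unflatten d (λ _ → r₀) (λ ht → α (flatten d (λ _ → r₀) ht) * u′ ht (i , y))) ⟩
            sumFin _ (λ k → α (flatten d (λ _ → r₀) (unflatten d (λ _ → r₀) k)) * u k (i , y))
              ≡⟨ sumFin-cong _ (λ k → cong (λ k′ → α k′ * u k (i , y)) (flatten-unflatten d (λ _ → r₀) k)) ⟩
            linComb _ α u (i , y) ∎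
            where
            open ≡-Reasoning
            rearrange : ∀ q a w → q * (a * w) ≡ a * (w * q)
            rearrange = solve-∀

  Ccal⇒Balanced : ∀ {m′} l → l ≤ suc m′ → (x : Fin (suc m′) → Zp p) → (∀ i j → red (x i) ≈ red (x j) → i ≡ j) →
    ∀ b → Ccal p x l b → Balanced l b
  Ccal⇒Balanced {m′} l l≤m x x-distinct b (r , A , cok) = d0 b i₀ , d₀≤d₀[i₀] , (begin
    (suc m′ ∸ l) ℕ.* d0 b i₀      ≡⟨ cong ((suc m′ ∸ l) ℕ.*_) (d₀≡rank i₀) ⟩
    (suc m′ ∸ l) ℕ.* rank i₀      ≤⟨ rank-inequality i₀ l≤m ⟩
    sumFinℕ (suc m′) rank         ≡⟨ sumFinℕ-cong (suc m′) (λ i → sym (d₀≡rank i)) ⟩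
    sumFinℕ (suc m′) (d0 b)       ∎)
    where
    open ℕₚ.≤-Reasoning
    B : ℕ → Fin (n b) → Fin (n b) → ℤ
    B j a c = seq (A j a c) 1
    open RankInequality l B (λ i → red (x i)) x-distinct
    d₀≡rank : ∀ i → d0 b i ≡ rank i
    d₀≡rank i = trans (cong (_∸ s (H b i)) (sym (rank+corank≡n cok-i (bases i)))) (ℕₚ.m+n∸n≡m (rank i) (s (H b i)))
      where
      cok-i : Cok (n b) (Q i) (s (H b i))
      cok-i = Cok-resp-≈ (λ a c → redEvalIntegral≈evalMatPoly l r (n b) A (x i) a c) (CokIso⇒Cok (cok i))
    i₀ = proj₁ (argmax m′ (d0 b))
    d₀≤d₀[i₀] = proj₂ (argmax m′ (d0 b))

  blockDiag⊎ : ∀ {a₁ b₁ a₂ b₂ : ℕ} → (Fin a₁ → Fin b₁ → ℤ) → (Fin a₂ → Fin b₂ → ℤ) →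
    Fin a₁ ⊎ Fin a₂ → Fin b₁ ⊎ Fin b₂ → ℤ
  blockDiag⊎ M₁ M₂ (inj₁ a) (inj₁ c) = M₁ a c
  blockDiag⊎ M₁ M₂ (inj₂ a) (inj₂ c) = M₂ a c
  blockDiag⊎ M₁ M₂ (inj₁ a) (inj₂ c) = + 0
  blockDiag⊎ M₁ M₂ (inj₂ a) (inj₁ c) = + 0

  blockDiag : ∀ {a₁ b₁ a₂ b₂ : ℕ} → (Fin a₁ → Fin b₁ → ℤ) → (Fin a₂ → Fin b₂ → ℤ) →
    Fin (a₁ ℕ.+ a₂) → Fin (b₁ ℕ.+ b₂) → ℤ
  blockDiag {a₁} {b₁} M₁ M₂ a c = blockDiag⊎ M₁ M₂ (splitAt a₁ a) (splitAt b₁ c)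

  module _ {a₁ b₁ a₂ b₂ : ℕ} (M₁ : Fin a₁ → Fin b₁ → ℤ) (M₂ : Fin a₂ → Fin b₂ → ℤ) where

    private
      M = blockDiag M₁ M₂
      M-↑ˡ↑ˡ : ∀ a c → M (a ↑ˡ a₂) (c ↑ˡ b₂) ≡ M₁ a c
      M-↑ˡ↑ˡ a c = cong₂ (blockDiag⊎ M₁ M₂) (Finₚ.splitAt-↑ˡ a₁ a a₂) (Finₚ.splitAt-↑ˡ b₁ c b₂)
      M-↑ˡ↑ʳ : ∀ a c → M (a ↑ˡ a₂) (b₁ ↑ʳ c) ≡ + 0
      M-↑ˡ↑ʳ a c = cong₂ (blockDiag⊎ M₁ M₂) (Finₚ.splitAt-↑ˡ a₁ a a₂) (Finₚ.splitAt-↑ʳ b₁ b₂ c)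
      M-↑ʳ↑ˡ : ∀ a c → M (a₁ ↑ʳ a) (c ↑ˡ b₂) ≡ + 0
      M-↑ʳ↑ˡ a c = cong₂ (blockDiag⊎ M₁ M₂) (Finₚ.splitAt-↑ʳ a₁ a₂ a) (Finₚ.splitAt-↑ˡ b₁ c b₂)
      M-↑ʳ↑ʳ : ∀ a c → M (a₁ ↑ʳ a) (b₁ ↑ʳ c) ≡ M₂ a c
      M-↑ʳ↑ʳ a c = cong₂ (blockDiag⊎ M₁ M₂) (Finₚ.splitAt-↑ʳ a₁ a₂ a) (Finₚ.splitAt-↑ʳ b₁ b₂ c)

    mulMV-blockDiagˡ : ∀ v k → mulMV M v (k ↑ˡ a₂) ≡ mulMV M₁ (λ c → v (c ↑ˡ b₂)) k
    mulMV-blockDiagˡ v k = begin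
      mulMV M v (k ↑ˡ a₂)
        ≡⟨ sumFin-++ b₁ b₂ _ ⟩
      sumFin b₁ (λ c → M (k ↑ˡ a₂) (c ↑ˡ b₂) * v (c ↑ˡ b₂)) + sumFin b₂ (λ c → M (k ↑ˡ a₂) (b₁ ↑ʳ c) * v (b₁ ↑ʳ c))
        ≡⟨ cong₂ _+_ (sumFin-cong b₁ (λ c → cong (_* v (c ↑ˡ b₂)) (M-↑ˡ↑ˡ k c)))
                     (trans (sumFin-cong b₂ (λ c → trans (cong (_* v (b₁ ↑ʳ c)) (M-↑ˡ↑ʳ k c)) (ℤₚ.*-zeroˡ (v (b₁ ↑ʳ c)))))
                            (sumFin-zero b₂)) ⟩
      mulMV M₁ (λ c → v (c ↑ˡ b₂)) k + + 0
        ≡⟨ ℤₚ.+-identityʳ _ ⟩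
      mulMV M₁ (λ c → v (c ↑ˡ b₂)) k ∎
      where open ≡-Reasoning

    mulMV-blockDiagʳ : ∀ v k → mulMV M v (a₁ ↑ʳ k) ≡ mulMV M₂ (λ c → v (b₁ ↑ʳ c)) k
    mulMV-blockDiagʳ v k = begin
      mulMV M v (a₁ ↑ʳ k)
        ≡⟨ sumFin-++ b₁ b₂ _ ⟩
      sumFin b₁ (λ c → M (a₁ ↑ʳ k) (c ↑ˡ b₂) * v (c ↑ˡ b₂)) + sumFin b₂ (λ c → M (a₁ ↑ʳ k) (b₁ ↑ʳ c) * v (b₁ ↑ʳ c))
        ≡⟨ cong₂ _+_ (trans (sumFin-cong b₁ (λ c → trans (cong (_* v (c ↑ˡ b₂)) (M-↑ʳ↑ˡ k c)) (ℤₚ.*-zeroˡ (v (c ↑ˡ b₂)))))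
                            (sumFin-zero b₁))
                     (sumFin-cong b₂ (λ c → cong (_* v (b₁ ↑ʳ c)) (M-↑ʳ↑ʳ k c))) ⟩
      + 0 + mulMV M₂ (λ c → v (b₁ ↑ʳ c)) k
        ≡⟨ ℤₚ.+-identityˡ _ ⟩
      mulMV M₂ (λ c → v (b₁ ↑ʳ c)) k ∎
      where open ≡-Reasoning

    mulMV-blockDiag-++ˡ : ∀ v₁ v₂ k → mulMV M (v₁ ++ᶠ v₂) (k ↑ˡ a₂) ≡ mulMV M₁ v₁ k
    mulMV-blockDiag-++ˡ v₁ v₂ k =
      trans (mulMV-blockDiagˡ (v₁ ++ᶠ v₂) k) (sumFin-cong b₁ (λ c → cong (M₁ k c *_) (lookup-++ˡ v₁ v₂ c)))

    mulMV-blockDiag-++ʳ : ∀ v₁ v₂ k → mulMV M (v₁ ++ᶠ v₂) (a₁ ↑ʳ k) ≡ mulMV M₂ v₂ k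
    mulMV-blockDiag-++ʳ v₁ v₂ k =
      trans (mulMV-blockDiagʳ (v₁ ++ᶠ v₂) k) (sumFin-cong b₂ (λ c → cong (M₂ k c *_) (lookup-++ʳ v₁ v₂ c)))

  Cok-blockDiag : ∀ {n₁ n₂ s₁ s₂} {M₁ : Fin n₁ → Fin n₁ → ℤ} {M₂ : Fin n₂ → Fin n₂ → ℤ} →
    Cok n₁ M₁ s₁ → Cok n₂ M₂ s₂ → Cok (n₁ ℕ.+ n₂) (blockDiag M₁ M₂) (s₁ ℕ.+ s₂)
  Cok-blockDiag {n₁} {n₂} {s₁} {s₂} {M₁} {M₂} c₁ c₂ = record
    { φ = blockDiag C₁.φ C₂.φ ; surjective = surjective ; kernel⊆image = kernel⊆image ; image⊆kernel = image⊆kernel }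
    where
    module C₁ = Cok c₁
    module C₂ = Cok c₂
    φ = blockDiag C₁.φ C₂.φ
    surjective : ∀ y → ∃ λ v → ∀ k → mulMV φ v k ≈ y k
    surjective y = v , ↑-elim s₁ s₂ (λ k → mulMV φ v k ≈ y k)
        (λ k → ≈-trans (≈-reflexive (mulMV-blockDiag-++ˡ C₁.φ C₂.φ v₁ v₂ k)) (proj₂ S₁ k))
        (λ k → ≈-trans (≈-reflexive (mulMV-blockDiag-++ʳ C₁.φ C₂.φ v₁ v₂ k)) (proj₂ S₂ k))
      where
      S₁ = C₁.surjective (λ k → y (k ↑ˡ s₂))
      S₂ = C₂.surjective (λ k → y (s₁ ↑ʳ k))
      v₁ = proj₁ S₁
      v₂ = proj₁ S₂
      v = v₁ ++ᶠ v₂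
    kernel⊆image : ∀ v → (∀ k → mulMV φ v k ≈ + 0) → ∃ λ w → ∀ k → mulMV (blockDiag M₁ M₂) w k ≈ v k
    kernel⊆image v φv≈0 = w , ↑-elim n₁ n₂ (λ k → mulMV (blockDiag M₁ M₂) w k ≈ v k)
        (λ k → ≈-trans (≈-reflexive (mulMV-blockDiag-++ˡ M₁ M₂ w₁ w₂ k)) (proj₂ K₁ k))
        (λ k → ≈-trans (≈-reflexive (mulMV-blockDiag-++ʳ M₁ M₂ w₁ w₂ k)) (proj₂ K₂ k))
      where
      K₁ = C₁.kernel⊆image (λ c → v (c ↑ˡ n₂)) (λ k → ≈-trans (≈-reflexive (sym (mulMV-blockDiagˡ C₁.φ C₂.φ v k))) (φv≈0 (k ↑ˡ s₂)))
      K₂ = C₂.kernel⊆image (λ c → v (n₁ ↑ʳ c)) (λ k → ≈-trans (≈-reflexive (sym (mulMV-blockDiagʳ C₁.φ C₂.φ v k))) (φv≈0 (s₁ ↑ʳ k)))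
      w₁ = proj₁ K₁
      w₂ = proj₁ K₂
      w = w₁ ++ᶠ w₂
    image⊆kernel : ∀ v w → (∀ k → mulMV (blockDiag M₁ M₂) w k ≈ v k) → ∀ k → mulMV φ v k ≈ + 0
    image⊆kernel v w Mw≈v = ↑-elim s₁ s₂ (λ k → mulMV φ v k ≈ + 0)
        (λ k → ≈-trans (≈-reflexive (mulMV-blockDiagˡ C₁.φ C₂.φ v k))
                 (C₁.image⊆kernel (λ c → v (c ↑ˡ n₂)) (λ c → w (c ↑ˡ n₂)) (λ k′ → ≈-trans (≈-reflexive (sym (mulMV-blockDiagˡ M₁ M₂ w k′))) (Mw≈v (k′ ↑ˡ n₂))) k))
        (λ k → ≈-trans (≈-reflexive (mulMV-blockDiagʳ C₁.φ C₂.φ v k))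
                 (C₂.image⊆kernel (λ c → v (n₁ ↑ʳ c)) (λ c → w (n₁ ↑ʳ c)) (λ k′ → ≈-trans (≈-reflexive (sym (mulMV-blockDiagʳ M₁ M₂ w k′))) (Mw≈v (n₁ ↑ʳ k′))) k))

  Cok-empty : ∀ {M : Fin 0 → Fin 0 → ℤ} → Cok 0 M 0
  Cok-empty = record { φ = λ () ; surjective = λ _ → (λ ()) , λ ()
                     ; kernel⊆image = λ _ _ → (λ ()) , λ () ; image⊆kernel = λ _ _ _ () }

  Cok-1×1-singular : ∀ {M : Fin 1 → Fin 1 → ℤ} → M Fin.zero Fin.zero ≈ + 0 → Cok 1 M 1
  Cok-1×1-singular {M} M≈0 = record
    { φ = λ _ _ → + 1
    ; surjective = λ y → (λ _ → y Fin.zero) , λ { Fin.zero → ≈-reflexive (φv≡v₀ (λ _ → y Fin.zero)) }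
    ; kernel⊆image = λ v φv≈0 → (λ _ → + 0) , λ { Fin.zero →
        ≈-trans (≈-reflexive (trans (ℤₚ.+-identityʳ _) (ℤₚ.*-zeroʳ (M Fin.zero Fin.zero))))
                (≈-sym (≈-trans (≈-reflexive (sym (φv≡v₀ v))) (φv≈0 Fin.zero))) }
    ; image⊆kernel = λ v w Mw≈v k → ≈-trans (≈-reflexive (φv≡v₀ v)) (≈-trans (≈-sym (Mw≈v Fin.zero))
        (≈-trans (≈-reflexive (ℤₚ.+-identityʳ _))
                 (≈-trans (*-cong M≈0 (≈-refl {w Fin.zero})) (≈-reflexive (ℤₚ.*-zeroˡ (w Fin.zero)))))) }
    where
    φv≡v₀ : ∀ v → mulMV {1} (λ _ _ → + 1) v Fin.zero ≡ v Fin.zero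
    φv≡v₀ v = trans (ℤₚ.+-identityʳ _) (ℤₚ.*-identityˡ (v Fin.zero))

  Cok-1×1-invertible : ∀ {M : Fin 1 → Fin 1 → ℤ} → M Fin.zero Fin.zero ≉ + 0 → Cok 1 M 0
  Cok-1×1-invertible {M} M≉0 = record
    { φ = λ () ; surjective = λ _ → (λ _ → + 0) , λ ()
    ; kernel⊆image = λ v _ → (λ _ → c⁻¹ * v Fin.zero) , λ { Fin.zero →
        ≈-trans (≈-reflexive (trans (ℤₚ.+-identityʳ _) (sym (ℤₚ.*-assoc c c⁻¹ (v Fin.zero)))))
                (≈-trans (*-cong (proj₂ (invertible c M≉0)) (≈-refl {v Fin.zero})) (≈-reflexive (ℤₚ.*-identityˡ (v Fin.zero)))) }
    ; image⊆kernel = λ _ _ _ () }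
    where
    c = M Fin.zero Fin.zero
    c⁻¹ = proj₁ (invertible c M≉0)

  module _ {m : ℕ} (l : ℕ) (ys : Fin m → ℤ) where

    Realizable : ∀ n → (Fin m → ℕ) → Set
    Realizable n s = ∃ λ (B : ℕ → Fin n → Fin n → ℤ) → ∀ i → Cok n (evalMatPoly l B (ys i)) (s i)

    Realizable-empty : Realizable 0 (λ _ → 0)
    Realizable-empty = (λ _ ()) , λ _ → Cok-empty

    Realizable-resp : ∀ {n n′ s s′} → n ≡ n′ → (∀ i → s i ≡ s′ i) → Realizable n s → Realizable n′ s′
    Realizable-resp refl s≗s′ (B , cok) = B , λ i → subst (Cok _ _) (s≗s′ i) (cok i)

    Realizable-+ : ∀ {n₁ n₂ s₁ s₂} → Realizable n₁ s₁ → Realizable n₂ s₂ → Realizable (n₁ ℕ.+ n₂) (λ i → s₁ i ℕ.+ s₂ i)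
    Realizable-+ {n₁} (B₁ , cok₁) (B₂ , cok₂) = (λ j → blockDiag (B₁ j) (B₂ j)) , λ i →
      Cok-resp-≈ (λ a c → ≈-reflexive (sym (eval-blockDiag (ys i) (splitAt n₁ a) (splitAt n₁ c))))
                 (Cok-blockDiag (cok₁ i) (cok₂ i))
      where
      eval-blockDiag : ∀ z a c → sumℤ (suc l) (λ j → blockDiag⊎ (B₁ j) (B₂ j) a c * z ^ j)
                               ≡ blockDiag⊎ (evalMatPoly l B₁ z) (evalMatPoly l B₂ z) a c
      eval-blockDiag z (inj₁ a) (inj₁ c) = refl
      eval-blockDiag z (inj₂ a) (inj₂ c) = refl
      eval-blockDiag z (inj₁ a) (inj₂ c) = trans (sumℤ-cong (suc l) (λ j _ → ℤₚ.*-zeroˡ (z ^ j))) (sumℤ-zero (suc l))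
      eval-blockDiag z (inj₂ a) (inj₁ c) = trans (sumℤ-cong (suc l) (λ j _ → ℤₚ.*-zeroˡ (z ^ j))) (sumℤ-zero (suc l))

  constantZp : ℤ → Zp p
  constantZp z = record { seq = λ _ → z ; coh = λ k → subst (λ w → (p ℕ.^ k) ℕ∣.∣ ∣ w ∣) (sym (ℤₚ.+-inverseʳ z)) ((p ℕ.^ k) ℕ∣.∣0) }

  Realizable⇒Ccal : ∀ {m} l (x : Fin m → Zp p) (b : Bm m) →
    Realizable l (λ i → red (x i)) (n b) (λ i → s (H b i)) → Ccal p x l b
  Realizable⇒Ccal l x b (B , cok) = 0 , A , λ i →
    Cok⇒CokIso (Cok-resp-≈ (λ a c → ≈-sym (redEvalIntegral≈evalMatPoly l 0 (n b) A (x i) a c)) (cok i))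
    where
    A : ℕ → MatZp p (n b)
    A j a c = constantZp (B j a c)

  prodFin : ∀ k → (Fin k → ℤ) → ℤ
  prodFin zero    f = + 1
  prodFin (suc k) f = f Fin.zero * prodFin k (λ j → f (Fin.suc j))

  prodFin≈0 : ∀ k f j → f j ≈ + 0 → prodFin k f ≈ + 0
  prodFin≈0 (suc k) f Fin.zero fⱼ≈0 =
    ≈-trans (*-cong fⱼ≈0 ≈-refl) (≈-reflexive (ℤₚ.*-zeroˡ (prodFin k (λ j → f (Fin.suc j)))))
  prodFin≈0 (suc k) f (Fin.suc j) fⱼ≈0 =
    ≈-trans (*-cong (≈-refl {f Fin.zero}) (prodFin≈0 k (λ j → f (Fin.suc j)) j fⱼ≈0)) (≈-reflexive (ℤₚ.*-zeroʳ (f Fin.zero)))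

  prodFin≉0 : ∀ k f → (∀ j → f j ≉ + 0) → prodFin k f ≉ + 0
  prodFin≉0 zero    f f≉0 = ¬1≈0
  prodFin≉0 (suc k) f f≉0 = *≉0 (f≉0 Fin.zero) (prodFin≉0 k (λ j → f (Fin.suc j)) (λ j → f≉0 (Fin.suc j)))

  HasDegree<-prodFin : ∀ k (f : Fin k → ℤ → ℤ) → (∀ j → HasDegree< 2 (f j)) → HasDegree< (suc k) (λ z → prodFin k (λ j → f j z))
  HasDegree<-prodFin zero    f f-deg = HasDegree<-const (+ 1)
  HasDegree<-prodFin (suc k) f f-deg =
    HasDegree<-* 1 (suc k) (f-deg Fin.zero) (HasDegree<-prodFin k (λ j → f (Fin.suc j)) (λ j → f-deg (Fin.suc j)))

  linearFactor : ℕ∞ → ℤ → ℤ → ℤ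
  linearFactor (fin zero)    a z = + 1
  linearFactor (fin (suc _)) a z = z - a
  linearFactor ∞             a z = z - a

  data ExponentView : ℕ∞ → Set where
    zero-exponent     : ExponentView (fin 0)
    positive-exponent : ∀ {e} → s (cyc e) ≡ 1 → (∀ a z → linearFactor e a z ≡ z - a) → ExponentView e

  exponentView : ∀ e → ExponentView e
  exponentView (fin zero)    = zero-exponent
  exponentView (fin (suc k)) = positive-exponent refl (λ _ _ → refl)
  exponentView ∞             = positive-exponent refl (λ _ _ → refl)

  HasDegree<-linearFactor : ∀ e a → HasDegree< 2 (linearFactor e a)
  HasDegree<-linearFactor e a with exponentView e
  ... | zero-exponent         = HasDegree<-mono {1} {2} (s≤s z≤n) (HasDegree<-const (+ 1))
  ... | positive-exponent _ f≡ = HasDegree<-resp {2} (λ z → sym (f≡ a z)) (HasDegree<-linear a)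

  module Generators {m : ℕ} (l : ℕ) (l≤m : l ≤ m) (ys : Fin m → ℤ) (ys-distinct : ∀ i j → ys i ≈ ys j → i ≡ j) where

    open import Data.Fin.Permutation using (_⟨$⟩ʳ_; _⟨$⟩ˡ_; inverseˡ; inverseʳ)
    open import Data.List.Properties using (length-++)
    open import Data.List.Relation.Binary.Permutation.Propositional.Properties using (↭-length)

    -- the constant zero polynomial
    Realizable-𝒜₁ : ∀ {b} → Acal (fin 1) m b → Realizable l ys (n b) (λ i → s (H b i))
    Realizable-𝒜₁ {b} (σ , e , 1≤e , _ , n≡1 , H↭) =
      Realizable-resp l ys (sym n≡1) (λ i → trans (sym (s-cyc (1≤e (σ ⟨$⟩ʳ i)))) (sym (↭-length (H↭ i)))) zero-polynomial
      where
      s-cyc : ∀ {e} → fin 1 ≤∞ e → s (cyc e) ≡ 1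
      s-cyc {fin (suc k)} _ = refl
      s-cyc {∞}           _ = refl
      s-cyc {fin zero}    (fin≤fin ())
      zero-polynomial : Realizable l ys 1 (λ _ → 1)
      zero-polynomial = (λ _ _ _ → + 0) , λ i →
        Cok-1×1-singular (≈-reflexive (trans (sumℤ-cong (suc l) (λ j _ → ℤₚ.*-zeroˡ (ys i ^ j))) (sumℤ-zero (suc l))))

    -- ∏_{j<l} (z - y_{σ⁻¹ j})^{[e_j > 0]}: the factor for position j vanishes exactly at the point sent to j
    Realizable-𝒜₀ : ∀ {b} → Acal (fin 0) l b → Realizable l ys (n b) (λ i → s (H b i))
    Realizable-𝒜₀ {b} (σ , e , _ , e≡0 , n≡1 , H↭) =
      Realizable-resp l ys (sym n≡1) (λ i → sym (↭-length (H↭ i))) (B , λ i → cok-at i)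
      where
      position : Fin l → Fin m
      position j = Fin.inject≤ j l≤m
      factor : Fin l → ℤ → ℤ
      factor j = linearFactor (e (position j)) (ys (σ ⟨$⟩ˡ position j))
      P-deg = HasDegree<-prodFin l factor (λ j → HasDegree<-linearFactor (e (position j)) _)
      B : ℕ → Fin 1 → Fin 1 → ℤ
      B j _ _ = proj₁ P-deg j
      B≡P : ∀ z → evalMatPoly l B z Fin.zero Fin.zero ≡ prodFin l (λ j → factor j z)
      B≡P z = sym (proj₂ P-deg z)
      zero≢positive : ∀ {e′} → e′ ≡ fin 0 → s (cyc e′) ≢ 1
      zero≢positive refl ()
      cok-at : ∀ i → Cok 1 (evalMatPoly l B (ys i)) (s (cyc (e (σ ⟨$⟩ʳ i))))
      cok-at i = cok-at′ (e (σ ⟨$⟩ʳ i)) refl (exponentView _)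
        where
        cok-at′ : ∀ eᵢ → e (σ ⟨$⟩ʳ i) ≡ eᵢ → ExponentView eᵢ → Cok 1 (evalMatPoly l B (ys i)) (s (cyc eᵢ))
        cok-at′ _ eᵢ≡0 zero-exponent =
          Cok-1×1-invertible (λ P≈0 → prodFin≉0 l _ factor≉0 (≈-trans (≈-reflexive (sym (B≡P (ys i)))) P≈0))
          where
          factor≉0 : ∀ j → factor j (ys i) ≉ + 0
          factor≉0 j = factor≉0′ (e (position j)) refl (exponentView _)
            where
            factor≉0′ : ∀ eⱼ → e (position j) ≡ eⱼ → ExponentView eⱼ → linearFactor eⱼ (ys (σ ⟨$⟩ˡ position j)) (ys i) ≉ + 0
            factor≉0′ _ _ zero-exponent = ¬1≈0
            factor≉0′ _ eⱼ≡ (positive-exponent sⱼ≡1 f≡) f≈0 = zero≢positive eᵢ≡0 (trans (cong (s ∘ cyc) (trans (cong e σi≡j) eⱼ≡)) sⱼ≡1)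
              where
              σi≡j : σ ⟨$⟩ʳ i ≡ position j
              σi≡j = trans (cong (σ ⟨$⟩ʳ_) (ys-distinct _ _ (-≈0⇒≈ (≈-trans (≈-reflexive (sym (f≡ _ _))) f≈0)))) (inverseʳ σ)
        cok-at′ eᵢ eᵢ≡ (positive-exponent sᵢ≡1 f≡) = subst (Cok 1 _) (sym sᵢ≡1)
          (Cok-1×1-singular (≈-trans (≈-reflexive (B≡P (ys i))) (prodFin≈0 l _ j₀ factor-vanishes)))
          where
          σi<l : toℕ (σ ⟨$⟩ʳ i) < l
          σi<l with l ℕ.≤? toℕ (σ ⟨$⟩ʳ i)
          ... | yes l≤σi = ⊥-elim (zero≢positive (trans (sym eᵢ≡) (e≡0 _ l≤σi)) sᵢ≡1)
          ... | no  l≰σi = ℕₚ.≰⇒> l≰σi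
          j₀ : Fin l
          j₀ = Fin.fromℕ< σi<l
          position-j₀ : position j₀ ≡ σ ⟨$⟩ʳ i
          position-j₀ = Finₚ.toℕ-injective (trans (Finₚ.toℕ-inject≤ j₀ l≤m) (Finₚ.toℕ-fromℕ< σi<l))
          factor-vanishes : factor j₀ (ys i) ≈ + 0
          factor-vanishes = ≈-reflexive (begin
            factor j₀ (ys i)                                          ≡⟨ cong (λ w → linearFactor (e w) (ys (σ ⟨$⟩ˡ w)) (ys i)) position-j₀ ⟩
            linearFactor (e (σ ⟨$⟩ʳ i)) (ys (σ ⟨$⟩ˡ (σ ⟨$⟩ʳ i))) (ys i) ≡⟨ cong₂ (λ e′ a → linearFactor e′ (ys a) (ys i)) eᵢ≡ (inverseˡ σ) ⟩
            linearFactor eᵢ (ys i) (ys i)                             ≡⟨ f≡ (ys i) (ys i) ⟩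
            ys i - ys i                                               ≡⟨ ℤₚ.+-inverseʳ (ys i) ⟩
            + 0                                                       ∎)
            where open ≡-Reasoning

    Gen⇒Realizable : ∀ {b} → Gen (Generator m l) b → Realizable l ys (n b) (λ i → s (H b i))
    Gen⇒Realizable gen-zero                = Realizable-empty l ys
    Gen⇒Realizable (gen-el (inj₁ a))       = Realizable-𝒜₀ a
    Gen⇒Realizable (gen-el (inj₂ a))       = Realizable-𝒜₁ a
    Gen⇒Realizable (gen-add {b} g₁ g₂)     =
      Realizable-resp l ys refl (λ i → sym (length-++ (H b i))) (Realizable-+ l ys (Gen⇒Realizable g₁) (Gen⇒Realizable g₂))
    Gen⇒Realizable (gen-iso (n≡ , H↭) g)   = Realizable-resp l ys n≡ (λ i → ↭-length (H↭ i)) (Gen⇒Realizable g)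

  Gen⇒Ccal : ∀ {m} l → l ≤ m → (x : Fin m → Zp p) → (∀ i j → red (x i) ≈ red (x j) → i ≡ j) →
    ∀ b → Gen (Generator m l) b → Ccal p x l b
  Gen⇒Ccal l l≤m x x-distinct b g =
    Realizable⇒Ccal l x b (Generators.Gen⇒Realizable l l≤m (λ i → red (x i)) x-distinct g)

module Combinatorics where

  open import Data.Nat using (_+_; _*_)
  open import Function.Base using (case_of_)
  open FiniteSums
  open import Data.Bool using (Bool; true; false; _∨_; if_then_else_)
  open import Data.Fin.Permutation as Perm using (Permutation′; _⟨$⟩ʳ_; lift₀; insert; insert-punchIn)
  open import Data.Vec.Functional using () renaming (_∷_ to _∷ᶠ_)

  fromBool : Bool → ℕ
  fromBool true  = 1
  fromBool false = 0

  count : ∀ m → (Fin m → Bool) → ℕ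
  count m P = sumFinℕ m (λ i → fromBool (P i))

  count≤ : ∀ m P → count m P ≤ m
  count≤ zero    P = z≤n
  count≤ (suc m) P = ℕₚ.+-mono-≤ (fromBool≤1 (P Fin.zero)) (count≤ m (λ i → P (Fin.suc i)))
    where
    fromBool≤1 : ∀ b → fromBool b ≤ 1
    fromBool≤1 true  = ℕₚ.≤-refl
    fromBool≤1 false = z≤n

  count-false : ∀ m → count m (λ _ → false) ≡ 0
  count-false zero    = refl
  count-false (suc m) = count-false m

  toℕ-punchIn-< : ∀ {n} (j : Fin (suc n)) (x : Fin n) → toℕ x < toℕ j → toℕ (punchIn j x) ≡ toℕ x
  toℕ-punchIn-< {suc n} (Fin.suc j) Fin.zero    _         = refl
  toℕ-punchIn-< {suc n} (Fin.suc j) (Fin.suc x) (s≤s x<j) = cong suc (toℕ-punchIn-< j x x<j)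

  frontPermutation : ∀ m (P : Fin m → Bool) → ∃ λ (σ : Permutation′ m) → ∀ i → P i ≡ true → toℕ (σ ⟨$⟩ʳ i) < count m P
  frontPermutation zero    P = Perm.id , λ ()
  frontPermutation (suc m) P with frontPermutation m (λ i → P (Fin.suc i)) | P Fin.zero in P₀
  ... | σ , σ-front | true  = lift₀ σ , λ { Fin.zero _ → s≤s z≤n ; (Fin.suc i) Pi → s≤s (σ-front i Pi) }
  ... | σ , σ-front | false = insert Fin.zero last σ , front
    where
    last : Fin (suc m)
    last = Fin.fromℕ< (s≤s (count≤ m (λ i → P (Fin.suc i))))
    front : ∀ i → P i ≡ true → toℕ (insert Fin.zero last σ ⟨$⟩ʳ i) < count m (λ i → P (Fin.suc i))
    front Fin.zero    P₀≡true = case trans (sym P₀) P₀≡true of λ ()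
    front (Fin.suc i) Pi = subst (_< _)
      (sym (trans (cong toℕ (insert-punchIn Fin.zero last σ i))
                  (toℕ-punchIn-< last (σ ⟨$⟩ʳ i) (subst (toℕ (σ ⟨$⟩ʳ i) <_) (sym (Finₚ.toℕ-fromℕ< _)) (σ-front i Pi)))))
      (σ-front i Pi)

  takeFirst : ∀ m → ℕ → (Fin m → Bool) → Fin m → Bool
  takeFirst zero    β       Q = λ ()
  takeFirst (suc m) zero    Q = λ _ → false
  takeFirst (suc m) (suc β) Q with Q Fin.zero
  ... | true  = true  ∷ᶠ takeFirst m β (λ i → Q (Fin.suc i))
  ... | false = false ∷ᶠ takeFirst m (suc β) (λ i → Q (Fin.suc i))

  takeFirst⊆ : ∀ m β Q i → takeFirst m β Q i ≡ true → Q i ≡ true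
  takeFirst⊆ (suc m) (suc β) Q i taken with Q Fin.zero in Q₀
  takeFirst⊆ (suc m) (suc β) Q Fin.zero    taken | true  = Q₀
  takeFirst⊆ (suc m) (suc β) Q (Fin.suc i) taken | true  = takeFirst⊆ m β (λ i → Q (Fin.suc i)) i taken
  takeFirst⊆ (suc m) (suc β) Q (Fin.suc i) taken | false = takeFirst⊆ m (suc β) (λ i → Q (Fin.suc i)) i taken

  count-takeFirst≤ : ∀ m β Q → count m (takeFirst m β Q) ≤ β
  count-takeFirst≤ zero    β       Q = z≤n
  count-takeFirst≤ (suc m) zero    Q = ℕₚ.≤-reflexive (count-false m)
  count-takeFirst≤ (suc m) (suc β) Q with Q Fin.zero
  ... | true  = s≤s (count-takeFirst≤ m β (λ i → Q (Fin.suc i)))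
  ... | false = count-takeFirst≤ m (suc β) (λ i → Q (Fin.suc i))

  takeFirst-full-or-all : ∀ m β Q → count m (takeFirst m β Q) ≡ β ⊎ (∀ i → Q i ≡ true → takeFirst m β Q i ≡ true)
  takeFirst-full-or-all zero    β       Q = inj₂ (λ ())
  takeFirst-full-or-all (suc m) zero    Q = inj₁ (count-false m)
  takeFirst-full-or-all (suc m) (suc β) Q with Q Fin.zero in Q₀
  ... | true with takeFirst-full-or-all m β (λ i → Q (Fin.suc i))
  ...   | inj₁ full = inj₁ (cong suc full)
  ...   | inj₂ all  = inj₂ (λ { Fin.zero _ → refl ; (Fin.suc i) Qi → all i Qi })
  takeFirst-full-or-all (suc m) (suc β) Q | false with takeFirst-full-or-all m (suc β) (λ i → Q (Fin.suc i))
  ...   | inj₁ full = inj₁ full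
  ...   | inj₂ all  = inj₂ (λ { Fin.zero Q₀≡true → case trans (sym Q₀) Q₀≡true of λ () ; (Fin.suc i) Qi → all i Qi })

  open import Relation.Nullary using (does)

  does-spec : ∀ {A : Set} (a? : Dec A) → (does a? ≡ true × A) ⊎ (does a? ≡ false × ¬ A)
  does-spec (yes a) = inj₁ (refl , a)
  does-spec (no ¬a) = inj₂ (refl , ¬a)

  does⇒ : ∀ {A : Set} (a? : Dec A) → does a? ≡ true → A
  does⇒ (yes a) _ = a

  record Selection (m l n′ : ℕ) (len : Fin m → ℕ) : Set where
    field
      chosen          : Fin m → Bool
      count≤l         : count m chosen ≤ l
      chosen⇒nonempty : ∀ i → chosen i ≡ true → 1 ≤ len i
      rest≤           : ∀ i → len i ∸ fromBool (chosen i) ≤ n′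
      sum-rest≤       : sumFinℕ m (λ i → len i ∸ fromBool (chosen i)) ≤ l * n′

  -- all rows of full length, topped up by the first further nonempty rows until l are chosen
  select : ∀ m l n′ (len : Fin m → ℕ) → (∀ i → len i ≤ suc n′) → sumFinℕ m len ≤ l * suc n′ → Selection m l n′ len
  select m l n′ len len≤ sum≤ = record
    { chosen = chosen ; count≤l = count≤l ; chosen⇒nonempty = chosen⇒nonempty ; rest≤ = rest≤ ; sum-rest≤ = sum-rest≤ }
    where
    open import Relation.Nullary.Decidable using (¬?; _×-dec_; dec-true)
    full? : ∀ i → Dec (len i ≡ suc n′)
    full? i = len i ℕ.≟ suc n′
    eligible? : ∀ i → Dec (1 ≤ len i × len i ≢ suc n′)
    eligible? i = (1 ℕ.≤? len i) ×-dec ¬? (full? i)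
    full eligible : Fin m → Bool
    full i = does (full? i)
    eligible i = does (eligible? i)
    full-spec : ∀ i → (full i ≡ true × len i ≡ suc n′) ⊎ (full i ≡ false × len i ≢ suc n′)
    full-spec i = does-spec (full? i)
    F = count m full
    topped-up : Fin m → Bool
    topped-up = takeFirst m (l ∸ F) eligible
    chosen : Fin m → Bool
    chosen i = full i ∨ topped-up i
    F≤l : F ≤ l
    F≤l = ℕₚ.*-cancelʳ-≤ F l (suc n′) (ℕₚ.≤-trans (ℕₚ.≤-reflexive (sym (sumFinℕ-*ʳ m (suc n′) (λ i → fromBool (full i)))))
                                                   (ℕₚ.≤-trans (sumFinℕ-mono-≤ m full-len) sum≤))
      where
      full-len : ∀ i → fromBool (full i) * suc n′ ≤ len i
      full-len i with full i | full-spec i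
      ... | true  | inj₁ (_ , len≡) = ℕₚ.≤-reflexive (trans (ℕₚ.+-identityʳ (suc n′)) (sym len≡))
      ... | false | _               = z≤n
    topped-up⇒eligible : ∀ i → topped-up i ≡ true → 1 ≤ len i × len i ≢ suc n′
    topped-up⇒eligible i t = does⇒ (eligible? i) (takeFirst⊆ m (l ∸ F) eligible i t)
    fromBool-chosen : ∀ i → fromBool (chosen i) ≡ fromBool (full i) + fromBool (topped-up i)
    fromBool-chosen i with full i | full-spec i | topped-up i in tᵢ
    ... | true  | inj₁ (_ , len≡) | true  = ⊥-elim (proj₂ (topped-up⇒eligible i tᵢ) len≡)
    ... | true  | _               | false = refl
    ... | false | _               | _     = refl
    count-chosen : count m chosen ≡ F + count m topped-up
    count-chosen = trans (sumFinℕ-cong m fromBool-chosen) (sumFinℕ-distrib-+ m _ _)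
    count≤l : count m chosen ≤ l
    count≤l = ℕₚ.≤-trans (ℕₚ.≤-reflexive count-chosen)
                         (ℕₚ.≤-trans (ℕₚ.+-monoʳ-≤ F (count-takeFirst≤ m (l ∸ F) eligible)) (ℕₚ.≤-reflexive (ℕₚ.m+[n∸m]≡n F≤l)))
    chosen⇒nonempty : ∀ i → chosen i ≡ true → 1 ≤ len i
    chosen⇒nonempty i cᵢ with full i | full-spec i | topped-up i in tᵢ
    ... | true  | inj₁ (_ , len≡) | _    = ℕₚ.≤-trans (s≤s z≤n) (ℕₚ.≤-reflexive (sym len≡))
    ... | false | _               | true = proj₁ (topped-up⇒eligible i tᵢ)
    rest≤ : ∀ i → len i ∸ fromBool (chosen i) ≤ n′
    rest≤ i with full i | full-spec i | topped-up i
    ... | true  | _                | _     = ℕₚ.∸-monoˡ-≤ 1 (len≤ i)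
    ... | false | _                | true  = ℕₚ.∸-monoˡ-≤ 1 (len≤ i)
    ... | false | inj₂ (_ , len≢)  | false = ℕₚ.≤-pred (ℕₚ.≤∧≢⇒< (len≤ i) len≢)
    rest+count≡sum : sumFinℕ m (λ i → len i ∸ fromBool (chosen i)) + count m chosen ≡ sumFinℕ m len
    rest+count≡sum = trans (sym (sumFinℕ-distrib-+ m _ _)) (sumFinℕ-cong m (λ i → ℕₚ.m∸n+n≡m (chosen≤len i)))
      where
      chosen≤len : ∀ i → fromBool (chosen i) ≤ len i
      chosen≤len i with chosen i in cᵢ
      ... | true  = chosen⇒nonempty i cᵢ
      ... | false = z≤n
    sum-rest≤ : sumFinℕ m (λ i → len i ∸ fromBool (chosen i)) ≤ l * n′
    sum-rest≤ with takeFirst-full-or-all m (l ∸ F) eligible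
    ... | inj₁ count≡ = ℕₚ.+-cancelʳ-≤ l _ (l * n′) (begin
      sumFinℕ m (λ i → len i ∸ fromBool (chosen i)) + l
        ≡⟨ cong (_+_ (sumFinℕ m (λ i → len i ∸ fromBool (chosen i)))) (sym (trans count-chosen (trans (cong (_+_ F) count≡) (ℕₚ.m+[n∸m]≡n F≤l)))) ⟩
      sumFinℕ m (λ i → len i ∸ fromBool (chosen i)) + count m chosen
        ≡⟨ rest+count≡sum ⟩
      sumFinℕ m len                     ≤⟨ sum≤ ⟩
      l * suc n′                        ≡⟨ trans (ℕₚ.*-suc l n′) (ℕₚ.+-comm l (l * n′)) ⟩
      l * n′ + l                        ∎)
      where open ℕₚ.≤-Reasoning
    ... | inj₂ all-eligible = ℕₚ.≤-trans (ℕₚ.+-cancelʳ-≤ c _ (c * n′) (begin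
      sumFinℕ m (λ i → len i ∸ fromBool (chosen i)) + c ≡⟨ rest+count≡sum ⟩
      sumFinℕ m len                                     ≤⟨ sumFinℕ-mono-≤ m len≤chosen ⟩
      sumFinℕ m (λ i → fromBool (chosen i) * suc n′)    ≡⟨ sumFinℕ-*ʳ m (suc n′) _ ⟩
      c * suc n′                                        ≡⟨ trans (ℕₚ.*-suc c n′) (ℕₚ.+-comm c (c * n′)) ⟩
      c * n′ + c                                        ∎))
      (ℕₚ.*-monoˡ-≤ n′ count≤l)
      where
      open ℕₚ.≤-Reasoning
      c = count m chosen
      -- an unchosen row is neither full nor eligible, hence empty
      len≤chosen : ∀ i → len i ≤ fromBool (chosen i) * suc n′
      len≤chosen i with full i | full-spec i | topped-up i in tᵢ
      ... | true  | _               | _     = ℕₚ.≤-trans (len≤ i) (ℕₚ.≤-reflexive (sym (ℕₚ.+-identityʳ (suc n′))))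
      ... | false | _               | true  = ℕₚ.≤-trans (len≤ i) (ℕₚ.≤-reflexive (sym (ℕₚ.+-identityʳ (suc n′))))
      ... | false | inj₂ (_ , len≢) | false with 1 ℕ.≤? len i
      ...   | yes 1≤len = case trans (sym (all-eligible i (dec-true (eligible? i) (1≤len , len≢)))) tᵢ of λ ()
      ...   | no  1≰len = ℕₚ.≤-reflexive (ℕₚ.n<1⇒n≡0 (ℕₚ.≰⇒> 1≰len))

  open import Data.List using ([]; _∷_; length; _++_; take; drop)
  open import Data.List.Properties using (take++drop≡id)
  open import Data.List.Relation.Binary.Permutation.Propositional using (↭-reflexive)

  headIf tailIf : Bool → FGMod → FGMod
  headIf b xs = if b then take 1 xs else []
  tailIf b xs = if b then drop 1 xs else xs

  headIf++tailIf : ∀ b xs → headIf b xs ++ tailIf b xs ≡ xs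
  headIf++tailIf true  xs = take++drop≡id 1 xs
  headIf++tailIf false xs = refl

  length-tailIf : ∀ b xs → length (tailIf b xs) ≡ length xs ∸ fromBool b
  length-tailIf true  []       = refl
  length-tailIf true  (_ ∷ xs) = refl
  length-tailIf false xs       = refl

  firstExponent : FGMod → ℕ∞
  firstExponent []           = fin 0
  firstExponent (pfin k ∷ _) = fin (suc k)
  firstExponent (pinf ∷ _)   = ∞

  cyc-firstExponent : ∀ xs → cyc (firstExponent (take 1 xs)) ≡ take 1 xs
  cyc-firstExponent []           = refl
  cyc-firstExponent (pfin k ∷ _) = refl
  cyc-firstExponent (pinf ∷ _)   = refl

  0≤firstExponent : ∀ xs → fin 0 ≤∞ firstExponent xs
  0≤firstExponent []           = fin≤fin z≤n
  0≤firstExponent (pfin _ ∷ _) = fin≤fin z≤n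
  0≤firstExponent (pinf ∷ _)   = fin 0 ≤∞∞

  1≤firstExponent : ∀ xs → 1 ≤ length xs → fin 1 ≤∞ firstExponent (take 1 xs)
  1≤firstExponent (pfin _ ∷ _) _ = fin≤fin (s≤s z≤n)
  1≤firstExponent (pinf ∷ _)   _ = fin 1 ≤∞∞

  module Decomposition (m l : ℕ) (l≤m : l ≤ m) where

    open import Data.Fin.Permutation using (_⟨$⟩ˡ_; inverseˡ; inverseʳ)

    𝒜₁-row : ∀ (H : Fin m → FGMod) → (∀ i → 1 ≤ length (H i)) → Acal (fin 1) m ⟨ 1 ⨾ (λ i → take 1 (H i)) ⟩
    𝒜₁-row H nonempty = Perm.id , (λ j → firstExponent (take 1 (H j))) , (λ j → 1≤firstExponent (H j) (nonempty j))
                      , (λ j m≤j → ⊥-elim (ℕₚ.<⇒≱ (Finₚ.toℕ<n j) m≤j))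
                      , refl , λ i → ↭-reflexive (sym (cyc-firstExponent (H i)))

    𝒜₀-row : ∀ (H : Fin m → FGMod) (N : Fin m → Bool) → count m N ≤ l →
      Acal (fin 0) l ⟨ 1 ⨾ (λ i → headIf (N i) (H i)) ⟩
    𝒜₀-row H N count≤l = σ , e , (λ j → 0≤firstExponent _) , beyond-l , refl , λ i → ↭-reflexive (sym (cyc-e i))
      where
      σ = proj₁ (frontPermutation m N)
      e : Fin m → ℕ∞
      e j = firstExponent (headIf (N (σ ⟨$⟩ˡ j)) (H (σ ⟨$⟩ˡ j)))
      beyond-l : ∀ j → l ≤ toℕ j → e j ≡ fin 0
      beyond-l j l≤j with N (σ ⟨$⟩ˡ j) in Nⱼ
      ... | true  = ⊥-elim (ℕₚ.<⇒≱ (ℕₚ.<-≤-trans (subst (λ w → toℕ w < count m N) (inverseʳ σ) (proj₂ (frontPermutation m N) _ Nⱼ))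
                                                 count≤l) l≤j)
      ... | false = refl
      cyc-headIf : ∀ b xs → cyc (firstExponent (headIf b xs)) ≡ headIf b xs
      cyc-headIf true  xs = cyc-firstExponent xs
      cyc-headIf false xs = refl
      cyc-e : ∀ i → cyc (e (σ ⟨$⟩ʳ i)) ≡ headIf (N i) (H i)
      cyc-e i = trans (cong (λ w → cyc (firstExponent (headIf (N w) (H w)))) (inverseˡ σ)) (cyc-headIf (N i) (H i))

    decompose-short : ∀ n (H : Fin m → FGMod) → (∀ i → length (H i) ≤ n) → sumFinℕ m (λ i → length (H i)) ≤ l * n →
      Gen (Generator m l) ⟨ n ⨾ H ⟩
    decompose-short zero     H len≤ _ = gen-iso (refl , λ i → ↭-reflexive (sym (empty (H i) (len≤ i)))) gen-zero
      where
      empty : ∀ xs → length xs ≤ 0 → xs ≡ []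
      empty [] _ = refl
    decompose-short (suc n′) H len≤ sum≤ =
      gen-iso (refl , λ i → ↭-reflexive (headIf++tailIf (chosen i) (H i)))
              (gen-add (gen-el (inj₁ (𝒜₀-row H chosen count≤l)))
                       (decompose-short n′ (λ i → tailIf (chosen i) (H i))
                                        (λ i → subst (_≤ n′) (sym (length-tailIf (chosen i) (H i))) (rest≤ i))
                                        (subst (_≤ l * n′) (sumFinℕ-cong m (λ i → sym (length-tailIf (chosen i) (H i)))) sum-rest≤)))
      where open Selection (select m l n′ (λ i → length (H i)) len≤ sum≤)

    -- while α₀ < n every H i is nonempty and a row of 𝒜₁,m can be split off; once α₀ ≥ n the balance
    -- condition bounds the total length by l n
    decompose : ∀ n (H : Fin m → FGMod) → (∀ i → length (H i) ≤ n) → Balanced l ⟨ n ⨾ H ⟩ → Gen (Generator m l) ⟨ n ⨾ H ⟩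
    decompose n H len≤ (α , d₀≤α , balance) with α ℕ.<? n
    ... | no α≮n = decompose-short n H len≤ (ℕₚ.+-cancelˡ-≤ ((m ∸ l) * n) _ _ (begin
      (m ∸ l) * n + sumFinℕ m len                    ≤⟨ ℕₚ.+-monoˡ-≤ _ (ℕₚ.≤-trans (ℕₚ.*-monoʳ-≤ (m ∸ l) (ℕₚ.≮⇒≥ α≮n)) balance) ⟩
      sumFinℕ m (λ i → n ∸ len i) + sumFinℕ m len    ≡⟨ sym (sumFinℕ-distrib-+ m _ _) ⟩
      sumFinℕ m (λ i → n ∸ len i ℕ.+ len i)          ≡⟨ trans (sumFinℕ-cong m (λ i → ℕₚ.m∸n+n≡m (len≤ i))) (sumFinℕ-const m n) ⟩
      m * n                                          ≡⟨ trans (cong (_* n) (sym (ℕₚ.m∸n+n≡m l≤m))) (ℕₚ.*-distribʳ-+ n (m ∸ l) l) ⟩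
      (m ∸ l) * n + l * n                            ∎))
      where
      open ℕₚ.≤-Reasoning
      len : Fin m → ℕ
      len i = length (H i)
    decompose (suc n′) H len≤ (α , d₀≤α , balance) | yes α<n =
      gen-iso (refl , λ i → ↭-reflexive (take++drop≡id 1 (H i)))
              (gen-add (gen-el (inj₂ (𝒜₁-row H nonempty)))
                       (decompose n′ (λ i → drop 1 (H i)) (λ i → length-drop (H i) (len≤ i))
                                  (α , (λ i → subst (_≤ α) (sym (d₀-drop i)) (d₀≤α i))
                                     , subst ((m ∸ l) * α ≤_) (sym (sumFinℕ-cong m d₀-drop)) balance)))
      where
      nonempty : ∀ i → 1 ≤ length (H i)
      nonempty i with H i | d₀≤α i
      ... | []    | n≤α = ⊥-elim (ℕₚ.<⇒≱ α<n n≤α)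
      ... | _ ∷ _ | _   = s≤s z≤n
      d₀-drop : ∀ i → n′ ∸ length (drop 1 (H i)) ≡ suc n′ ∸ length (H i)
      d₀-drop i with H i | nonempty i
      ... | _ ∷ _ | _ = refl
      length-drop : ∀ xs → length xs ≤ suc n′ → length (drop 1 xs) ≤ n′
      length-drop []       _            = z≤n
      length-drop (_ ∷ xs) (s≤s len≤n′) = len≤n′

open import Data.Nat using (_*_)

theorem3p12 : (p : ℕ) → Prime p → (m l : ℕ) → 1 ≤ l → l ≤ m →
    (x : Fin m → Zp p) → (∀ i j → red (x i) ≡[mod p ] red (x j) → i ≡ j) →
    ((b : Bm m) → InB b → (Ccal p x l b ⇔ Gen (λ c → Acal (fin 0) l c ⊎ Acal (fin 1) m c) b))
    × ((b : Bm m) → InB b →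
        (Ccal p x l b ⇔ Σ ℕ (λ α₀ → (∀ i → d0 b i ≤ α₀) × ((m ∸ l) * α₀ ≤ sumFinℕ m (d0 b)))))
theorem3p12 p p-prime zero     l (s≤s z≤n) () x x-distinct
theorem3p12 p p-prime (suc m′) l 1≤l l≤m x x-distinct =
  (λ b b∈B → mk⇔ (balanced⇒Gen b b∈B ∘ necessity b) (sufficiency b)) ,
  (λ b b∈B → mk⇔ (necessity b) (sufficiency b ∘ balanced⇒Gen b b∈B))
  where
  open ModPrime p p-prime using (≈⇒≡[mod]; Ccal⇒Balanced; Gen⇒Ccal)
  distinct = λ i j xᵢ≈xⱼ → x-distinct i j (≈⇒≡[mod] xᵢ≈xⱼ)
  necessity : ∀ b → Ccal p x l b → Balanced l b
  necessity = Ccal⇒Balanced l l≤m x distinct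
  sufficiency : ∀ b → Gen (Generator (suc m′) l) b → Ccal p x l b
  sufficiency = Gen⇒Ccal l l≤m x distinct
  balanced⇒Gen : ∀ b → InB b → Balanced l b → Gen (Generator (suc m′) l) b
  balanced⇒Gen b = Combinatorics.Decomposition.decompose (suc m′) l l≤m (n b) (H b)
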